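{- Let $n\geq 3$ be an integer and let $G$ be a finite group with a subgroup $H=\langle x,y\mid x^{2^n}=e,\ y^2=e,\ x^y=x^{ -1+2^{n-1}}\rangle$. Then $H$ is a perfect code of $G$ if and only if $a^2\in\langle x\rangle$ for each $a\in N_G(H)\setminus H$ with $a^2\in H$.
   Context: A perfect code in a simple undirected graph with vertex set $V$ is an independent subset $C\subseteq V$ such that every vertex in $V\setminus C$ is adjacent to exactly one vertex of $C$. For a group $G$ with identity $e$ and an inverse-closed $S\subseteq G\setminus\{e\}$, the Cayley graph $\mathrm{Cay}(G,S)$ has vertex set $G$ and edges $\{g,sg\}$ ($s\in S$, $g\in G$). A subset $C$ of $G$ is a perfect code of $G$ if it is a perfect code in some Cayley graph $\mathrm{Cay}(G,S)$. Notation: $x^y=y^{ -1}xy$. -}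

module Defs where

open import Data.Nat using (ℕ; zero; suc)
open import Data.Fin using (Fin)
open import Data.Fin.Subset using (Subset; _∈_; _∉_)
open import Data.Product using (Σ; _×_; _,_)
open import Data.Sum using (_⊎_)
open import Relation.Nullary using (¬_)
open import Relation.Binary.PropositionalEquality using (_≡_)
open import Algebra.Core using (Op₁; Op₂)
open import Algebra.Structures using (IsGroup)

-- A finite group: carrier Fin order, with group laws w.r.t. propositional equality.
-- (Every finite group is isomorphic to one of this form.)
record FiniteGroup : Set where
  infixl 7 _∙_
  infix 8 _⁻¹
  field
    order   : ℕ
    _∙_     : Op₂ (Fin order)
    ε       : Fin order
    _⁻¹     : Op₁ (Fin order)
    isGroup : IsGroup _≡_ _∙_ ε _⁻¹

  Carrier : Set
  Carrier = Fin order

  pow : Carrier → ℕ → Carrier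
  pow g zero    = ε
  pow g (suc k) = g ∙ pow g k

  _ˆ_ : Carrier → Carrier → Carrier
  g ˆ h = h ⁻¹ ∙ g ∙ h

  data ⟨_⟩ (X : Carrier → Set) : Carrier → Set where
    gen : ∀ {g} → X g → ⟨ X ⟩ g
    one : ⟨ X ⟩ ε
    mul : ∀ {g h} → ⟨ X ⟩ g → ⟨ X ⟩ h → ⟨ X ⟩ (g ∙ h)
    inv : ∀ {g} → ⟨ X ⟩ g → ⟨ X ⟩ (g ⁻¹)

  ⟨_⟩₁ : Carrier → Carrier → Set
  ⟨ g ⟩₁ = ⟨ (λ z → z ≡ g) ⟩

  ⟨_,_⟩₂ : Carrier → Carrier → Carrier → Set
  ⟨ g , h ⟩₂ = ⟨ (λ z → z ≡ g ⊎ z ≡ h) ⟩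

  Normalizer : (Carrier → Set) → Carrier → Set
  Normalizer H a = ∀ h → (H h → H (h ˆ a)) × (H (h ˆ a) → H h)

  Adj : Subset order → Carrier → Carrier → Set
  Adj S g h = Σ Carrier (λ s → s ∈ S × h ≡ s ∙ g)

  IsPerfectCodeIn : Subset order → (Carrier → Set) → Set
  IsPerfectCodeIn S C =
    (∀ c c' → C c → C c' → ¬ Adj S c c')
    × (∀ v → ¬ C v → Σ Carrier (λ c → C c × Adj S v c × (∀ c' → C c' → Adj S v c' → c' ≡ c)))

  IsConnectionSet : Subset order → Set
  IsConnectionSet S = ε ∉ S × (∀ s → s ∈ S → s ⁻¹ ∈ S)

  IsPerfectCodeOf : (Carrier → Set) → Set
  IsPerfectCodeOf C = Σ (Subset order) (λ S → IsConnectionSet S × IsPerfectCodeIn S C)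

-- For a subgroup H of 2-power order, the number of right cosets in a double coset H g H divides
-- |H|, so it is 1 or even. Hence every coset H r can be paired with a coset inside H r⁻¹ H so that
-- only the cosets with H r H = H r = H r⁻¹ H are paired with themselves; giving paired cosets
-- mutually inverse elements and self-paired ones an involution yields an inverse-closed connection
-- set in which H is a perfect code. So H is a perfect code as soon as H a contains an involution
-- whenever a ∈ N(H) ∖ H and a² ∈ H.
--
-- For the semidihedral H = ⟨x, y⟩, elements of H outside ⟨x⟩ have order at most 4, so ⟨x⟩ is
-- characteristic in H. If a ∈ N(H) and a² ∈ ⟨x⟩, conjugation by a is an involutive automorphism
-- of ⟨x⟩, hence sends x to x, x c, x⁻¹ or x⁻¹ c, where c = x^(2^(n-1)); in each case an involution
-- in H a is written down, using that z ↦ z · y z y is a homomorphism from ⟨x⟩ onto {1, c} whose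
-- kernel is the subgroup of squares. Conversely, if H is a perfect code in Cay(G, S) and s ∈ S
-- moves a into H, then s is an involution normalising H, and a² = (s c₀)² ∈ ⟨x⟩ for c₀ = s a.

module Submission where

open import Defs
open import Data.Nat using (ℕ; _+_; _≤_; _∸_; _^_; suc; s≤s)
open import Relation.Nullary using (¬_)
open import Relation.Unary using (Decidable)
open import Relation.Binary.PropositionalEquality using (_≡_; _≢_)
open import Function.Bundles using (_⇔_; mk⇔)

module Counting where

  open import Data.Nat using (ℕ; zero; suc; _+_; _*_; _<_; _≤_; z≤n; s≤s; _≡ᵇ_)
  open import Data.Nat.Properties
    using ( ≡ᵇ⇒≡; ≡⇒≡ᵇ; +-0-commutativeMonoid; +-*-semiring; +-identityʳ; *-identityʳ; *-zeroʳ
          ; +-monoʳ-<; +-cancelˡ-≡; 0≢1+n; ≤-trans)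
  open import Data.Bool using (Bool; true; false; _∧_; T; if_then_else_)
  open import Data.Bool.Properties using (∧-identityʳ)
  open import Data.Fin using (Fin; zero; suc)
  open import Data.Fin.Properties using (suc-injective) renaming (_≟_ to _≟ᶠ_)
  open import Data.Maybe using (Maybe; just; nothing)
  import Data.Maybe as Maybe
  open import Data.Product using (Σ; _×_; _,_; proj₁; proj₂)
  open import Data.Sum using (_⊎_; inj₁; inj₂)
  open import Data.Empty using (⊥-elim)
  open import Data.Unit using (tt)
  open import Relation.Nullary using (¬_; Dec; yes; no)
  open import Relation.Nullary.Decidable using (⌊_⌋; toWitness; fromWitness; does-⇔; isYes≗does)
  open import Function.Bundles using (_⇔_)
  open import Relation.Binary.PropositionalEquality
  open import Function using (_∘_)
  open import Algebra.Properties.CommutativeMonoid.Sum +-0-commutativeMonoid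
    using (sum; sum-cong-≗; sum-replicate-zero; ∑-distrib-+; ∑-comm)
  open import Algebra.Properties.Semiring.Sum +-*-semiring using (*-distribˡ-sum)

  private
    variable
      m n : ℕ

  indicator : Bool → ℕ
  indicator b = if b then 1 else 0

  count : (Fin n → Bool) → ℕ
  count P = sum (indicator ∘ P)

  infix 4 _==_
  _==_ : Fin n → Fin n → Bool
  i == j = ⌊ i ≟ᶠ j ⌋

  T-∧-intro : ∀ {a b} → T a → T b → T (a ∧ b)
  T-∧-intro {true} {true} _ _ = tt

  T-∧-proj₁ : ∀ {a b} → T (a ∧ b) → T a
  T-∧-proj₁ {true} _ = tt

  T-∧-proj₂ : ∀ {a b} → T (a ∧ b) → T b
  T-∧-proj₂ {true} t = t

  ⌊⌋-⇔ : ∀ {A B : Set} → A ⇔ B → (a? : Dec A) (b? : Dec B) → ⌊ a? ⌋ ≡ ⌊ b? ⌋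
  ⌊⌋-⇔ A⇔B a? b? = trans (isYes≗does a?) (trans (does-⇔ A⇔B a? b?) (sym (isYes≗does b?)))

  indicator-T : ∀ {b} → T b → indicator b ≡ 1
  indicator-T {true} _ = refl

  indicator-¬T : ∀ {b} → ¬ T b → indicator b ≡ 0
  indicator-¬T {true}  ¬t = ⊥-elim (¬t tt)
  indicator-¬T {false} _  = refl

  sum-zero : (f : Fin n → ℕ) → (∀ j → f j ≡ 0) → sum f ≡ 0
  sum-zero {n} f f≡0 = trans (sum-cong-≗ f≡0) (sum-replicate-zero n)

  sum-single : (f : Fin n → ℕ) (i : Fin n) → (∀ j → j ≢ i → f j ≡ 0) → sum f ≡ f i
  sum-single f zero    f≡0 = trans (cong (f zero +_) (sum-zero (f ∘ suc) (λ j → f≡0 (suc j) λ ()))) (+-identityʳ (f zero))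
  sum-single f (suc i) f≡0 = cong₂ _+_ (f≡0 zero λ ()) (sum-single (f ∘ suc) i λ j j≢i → f≡0 (suc j) (j≢i ∘ suc-injective))

  sum-scaled-indicator : (Q : Fin n → Bool) (f : Fin n → ℕ) (s : ℕ) →
    (∀ j → T (Q j) → f j ≡ s) → (∀ j → ¬ T (Q j) → f j ≡ 0) → sum f ≡ s * count Q
  sum-scaled-indicator Q f s on off = trans (sum-cong-≗ f≗) (sym (*-distribˡ-sum s (indicator ∘ Q)))
    where
    f≗ : ∀ j → f j ≡ s * indicator (Q j)
    f≗ j with Q j in eq
    ... | true  = trans (on j (subst T (sym eq) tt)) (sym (*-identityʳ s))
    ... | false = trans (off j (subst T eq)) (sym (*-zeroʳ s))

  count-cong : {P Q : Fin n → Bool} → (∀ i → P i ≡ Q i) → count P ≡ count Q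
  count-cong P≗Q = sum-cong-≗ (cong indicator ∘ P≗Q)

  count-all : (P : Fin n → Bool) → (∀ i → T (P i)) → count P ≡ n
  count-all {zero}  P all = refl
  count-all {suc n} P all = cong₂ _+_ (indicator-T (all zero)) (count-all (P ∘ suc) (all ∘ suc))

  count-none : (P : Fin n → Bool) → (∀ i → ¬ T (P i)) → count P ≡ 0
  count-none P none = sum-zero _ (indicator-¬T ∘ none)

  count-singleton : (P : Fin n → Bool) (i : Fin n) → T (P i) → (∀ j → T (P j) → j ≡ i) → count P ≡ 1
  count-singleton P i Pi unique =
    trans (sum-single _ i λ j j≢i → indicator-¬T (j≢i ∘ unique j)) (indicator-T Pi)

  fibre : (Fin n → Bool) → (Fin n → Fin m) → Fin m → Fin n → Bool
  fibre P f j i = P i ∧ (f i == j)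

  count-fibres-sum : (P : Fin n → Bool) (f : Fin n → Fin m) →
    count P ≡ sum (λ j → count (fibre P f j))
  count-fibres-sum P f = trans (sum-cong-≗ split) (∑-comm λ i j → indicator (fibre P f j i))
    where
    split : ∀ i → indicator (P i) ≡ sum (λ j → indicator (fibre P f j i))
    split i = sym (trans (sum-single _ (f i) off) on)
      where
      off : ∀ j → j ≢ f i → indicator (P i ∧ (f i == j)) ≡ 0
      off j j≢fi = indicator-¬T λ t → j≢fi (sym (toWitness (T-∧-proj₂ {P i} t)))
      on : indicator (P i ∧ (f i == f i)) ≡ indicator (P i)
      on with f i ≟ᶠ f i
      ... | yes _    = cong indicator (∧-identityʳ (P i))
      ... | no fi≢fi = ⊥-elim (fi≢fi refl)

  count-fibres : (P : Fin n → Bool) (Q : Fin m → Bool) (f : Fin n → Fin m) (s : ℕ) →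
    (∀ i → T (P i) → T (Q (f i))) → (∀ j → T (Q j) → count (fibre P f j) ≡ s) →
    count P ≡ s * count Q
  count-fibres P Q f s f∈Q size = trans (count-fibres-sum P f) (sum-scaled-indicator Q _ s size empty)
    where
    empty : ∀ j → ¬ T (Q j) → count (fibre P f j) ≡ 0
    empty j j∉Q = count-none _ λ i t →
      j∉Q (subst (T ∘ Q) (toWitness (T-∧-proj₂ {P i} t)) (f∈Q i (T-∧-proj₁ t)))

  count-bijection : (P : Fin n → Bool) (Q : Fin m → Bool) (f : Fin n → Fin m) (g : Fin m → Fin n) →
    (∀ i → T (P i) → T (Q (f i))) → (∀ j → T (Q j) → T (P (g j))) →
    (∀ i → T (P i) → g (f i) ≡ i) → (∀ j → T (Q j) → f (g j) ≡ j) → count P ≡ count Q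
  count-bijection P Q f g f∈Q g∈P gf fg =
    trans (count-fibres P Q f 1 f∈Q singleton) (+-identityʳ (count Q))
    where
    singleton : ∀ j → T (Q j) → count (fibre P f j) ≡ 1
    singleton j Qj = count-singleton _ (g j) (T-∧-intro (g∈P j Qj) (fromWitness (fg j Qj)))
      λ i t → trans (sym (gf i (T-∧-proj₁ t))) (cong g (toWitness (T-∧-proj₂ {P i} t)))

  count-disjoint-∪ : (P Q R : Fin n → Bool) → (∀ i → T (R i) → T (P i) ⊎ T (Q i)) →
    (∀ i → T (P i) → T (R i)) → (∀ i → T (Q i) → T (R i)) → (∀ i → T (P i) → ¬ T (Q i)) →
    count R ≡ count P + count Q
  count-disjoint-∪ P Q R R⊆P∪Q P⊆R Q⊆R disjoint =
    trans (sum-cong-≗ split) (∑-distrib-+ (indicator ∘ P) (indicator ∘ Q))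
    where
    split : ∀ i → indicator (R i) ≡ indicator (P i) + indicator (Q i)
    split i with R i in r | P i in p | Q i in q
    ... | _     | true  | true  = ⊥-elim (disjoint i (subst T (sym p) tt) (subst T (sym q) tt))
    ... | true  | true  | false = refl
    ... | true  | false | true  = refl
    ... | false | true  | false = ⊥-elim (subst T r (P⊆R i (subst T (sym p) tt)))
    ... | false | false | true  = ⊥-elim (subst T r (Q⊆R i (subst T (sym q) tt)))
    ... | false | false | false = refl
    ... | true  | false | false with R⊆P∪Q i (subst T (sym r) tt)
    ...   | inj₁ Pi = ⊥-elim (subst T p Pi)
    ...   | inj₂ Qi = ⊥-elim (subst T q Qi)

  rank : (Fin n → Bool) → Fin n → ℕ
  rank P zero    = 0
  rank P (suc i) = indicator (P zero) + rank (P ∘ suc) i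

  rank<count : (P : Fin n → Bool) (i : Fin n) → T (P i) → rank P i < count P
  rank<count P zero    Pi rewrite indicator-T Pi = s≤s z≤n
  rank<count P (suc i) Pi = +-monoʳ-< (indicator (P zero)) (rank<count (P ∘ suc) i Pi)

  rank-surjective : (P : Fin n → Bool) (k : ℕ) → k < count P → Σ (Fin n) λ i → T (P i) × rank P i ≡ k
  rank-surjective {suc n} P k k<count with P zero in p
  rank-surjective {suc n} P zero    _            | true = zero , subst T (sym p) tt , refl
  rank-surjective {suc n} P (suc k) (s≤s k<count) | true with rank-surjective (P ∘ suc) k k<count
  ... | i , Pi , rank≡k = suc i , Pi , cong₂ _+_ (cong indicator p) rank≡k
  rank-surjective {suc n} P k k<count | false with rank-surjective (P ∘ suc) k k<count
  ... | i , Pi , rank≡k = suc i , Pi , cong₂ _+_ (cong indicator p) rank≡k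

  rank-injective : (P : Fin n → Bool) (i j : Fin n) → T (P i) → T (P j) → rank P i ≡ rank P j → i ≡ j
  rank-injective P zero    zero    _  _  _ = refl
  rank-injective P zero    (suc j) P0 _  e rewrite indicator-T P0 = ⊥-elim (0≢1+n e)
  rank-injective P (suc i) zero    _  P0 e rewrite indicator-T P0 = ⊥-elim (0≢1+n (sym e))
  rank-injective P (suc i) (suc j) Pi Pj e =
    cong suc (rank-injective (P ∘ suc) i j Pi Pj (+-cancelˡ-≡ (indicator (P zero)) _ _ e))

  rank-cong : {P Q : Fin n → Bool} → (∀ i → P i ≡ Q i) → ∀ i → rank P i ≡ rank Q i
  rank-cong P≗Q zero    = refl
  rank-cong P≗Q (suc i) = cong₂ _+_ (cong indicator (P≗Q zero)) (rank-cong (P≗Q ∘ suc) i)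

  2≤count : (P : Fin n → Bool) (i j : Fin n) → T (P i) → T (P j) → i ≢ j → 2 ≤ count P
  2≤count P i j Pi Pj i≢j with rank P i in ri | rank P j in rj
  ... | zero  | zero  = ⊥-elim (i≢j (rank-injective P i j Pi Pj (trans ri (sym rj))))
  ... | suc _ | _     = ≤-trans (s≤s (s≤s z≤n)) (subst (_< count P) ri (rank<count P i Pi))
  ... | zero  | suc _ = ≤-trans (s≤s (s≤s z≤n)) (subst (_< count P) rj (rank<count P j Pj))

  search : (Fin n → Bool) → Maybe (Fin n)
  search {zero}  P = nothing
  search {suc n} P = if P zero then just zero else Maybe.map suc (search (P ∘ suc))

  search-cong : {P Q : Fin n → Bool} → (∀ i → P i ≡ Q i) → search P ≡ search Q
  search-cong {zero}  P≗Q = refl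
  search-cong {suc n} P≗Q = cong₂ (λ b s → if b then just zero else s) (P≗Q zero)
    (cong (Maybe.map suc) (search-cong (P≗Q ∘ suc)))

  search-complete : (P : Fin n → Bool) (i : Fin n) → T (P i) → Σ (Fin n) λ j → search P ≡ just j × T (P j)
  search-complete {suc n} P i Pi with P zero in p
  ... | true = zero , refl , subst T (sym p) tt
  search-complete {suc n} P zero    Pi | false = ⊥-elim (subst T p Pi)
  search-complete {suc n} P (suc i) Pi | false with search-complete (P ∘ suc) i Pi
  ... | j , found , Pj = suc j , cong (Maybe.map suc) found , Pj

  -- Returns d if no index satisfies P.
  first : Fin n → (Fin n → Bool) → Fin n
  first d P with search P
  ... | just j  = j
  ... | nothing = d

  first-satisfies : (d : Fin n) (P : Fin n → Bool) (i : Fin n) → T (P i) → T (P (first d P))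
  first-satisfies d P i Pi with search P | search-complete P i Pi
  ... | just j | .j , refl , Pj = Pj

  first-cong : (d : Fin n) {P Q : Fin n → Bool} → (∀ i → P i ≡ Q i) → first d P ≡ first d Q
  first-cong d {P} {Q} P≗Q with search P | search Q | search-cong P≗Q
  ... | just j  | .(just j) | refl = refl
  ... | nothing | .nothing  | refl = refl

  -- Returns d if j ≥ count P.
  nth : Fin n → (Fin n → Bool) → ℕ → Fin n
  nth d P j = first d (λ i → P i ∧ (rank P i ≡ᵇ j))

  nth-satisfies : (d : Fin n) (P : Fin n → Bool) (j : ℕ) → j < count P → T (P (nth d P j)) × rank P (nth d P j) ≡ j
  nth-satisfies d P j j<count with rank-surjective P j j<count
  ... | i , Pi , rank≡j = T-∧-proj₁ found , ≡ᵇ⇒≡ _ j (T-∧-proj₂ {P (nth d P j)} found)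
    where found = first-satisfies d (λ i → P i ∧ (rank P i ≡ᵇ j)) i (T-∧-intro Pi (≡⇒≡ᵇ _ j rank≡j))

  nth-rank : (d : Fin n) (P : Fin n → Bool) (i : Fin n) → T (P i) → nth d P (rank P i) ≡ i
  nth-rank d P i Pi = rank-injective P _ i (proj₁ found) Pi (proj₂ found)
    where found = nth-satisfies d P (rank P i) (rank<count P i Pi)

  nth-cong : (d : Fin n) {P Q : Fin n → Bool} → (∀ i → P i ≡ Q i) → ∀ j → nth d P j ≡ nth d Q j
  nth-cong d P≗Q j = first-cong d λ i → cong₂ (λ b r → b ∧ (r ≡ᵇ j)) (P≗Q i) (rank-cong P≗Q i)

module NatFacts where

  open import Data.Nat using (ℕ; zero; suc; _+_; _*_; _^_; _<_; s≤s; z≤n)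
  open import Data.Nat.Properties using (+-suc; suc-injective; <-irrefl; ≤-trans)
  open import Data.Nat.Divisibility using (_∣_; divides; _∣?_; ∣-trans; ∣1⇒≡1; 0∣⇒≡0; ∣⇒≤)
  open import Data.Nat.Coprimality using (Coprime; coprime-divisor)
  open import Data.Product using (Σ; _,_)
  open import Data.Sum using (_⊎_; inj₁; inj₂)
  open import Data.Empty using (⊥-elim)
  open import Relation.Nullary using (¬_; yes; no; contradiction)
  open import Relation.Binary.PropositionalEquality
  open import Function using (_∘_)

  parity : ∀ t → Σ ℕ λ s → t ≡ s + s ⊎ t ≡ suc (s + s)
  parity zero = 0 , inj₁ refl
  parity (suc t) with parity t
  ... | s , inj₁ e = s , inj₂ (cong suc e)
  ... | s , inj₂ e = suc s , inj₁ (cong suc (trans e (sym (+-suc s s))))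

  odd-¬2∣ : ∀ s → ¬ 2 ∣ suc (s + s)
  odd-¬2∣ zero    (divides zero ())
  odd-¬2∣ zero    (divides (suc q) ())
  odd-¬2∣ (suc s) (divides (suc q) e) =
    odd-¬2∣ s (divides q (trans (sym (+-suc s s)) (suc-injective (suc-injective e))))

  odd⇒coprime-2 : ∀ d → ¬ 2 ∣ d → Coprime d 2
  odd⇒coprime-2 d ¬2∣d {zero}                (_ , 0∣2)  = contradiction (0∣⇒≡0 0∣2) λ ()
  odd⇒coprime-2 d ¬2∣d {suc zero}            _          = refl
  odd⇒coprime-2 d ¬2∣d {suc (suc zero)}      (2∣d , _)  = ⊥-elim (¬2∣d 2∣d)
  odd⇒coprime-2 d ¬2∣d {suc (suc (suc e))}   (_ , e∣2) = ⊥-elim (<-irrefl refl (≤-trans (s≤s (s≤s (s≤s z≤n))) (∣⇒≤ e∣2)))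

  ∣2^k⇒≡1⊎even : ∀ k d → d ∣ 2 ^ k → d ≡ 1 ⊎ 2 ∣ d
  ∣2^k⇒≡1⊎even zero    d d∣1 = inj₁ (∣1⇒≡1 d∣1)
  ∣2^k⇒≡1⊎even (suc k) d d∣2^k with 2 ∣? d
  ... | yes 2∣d  = inj₂ 2∣d
  ... | no ¬2∣d = ∣2^k⇒≡1⊎even k d (coprime-divisor (odd⇒coprime-2 d ¬2∣d) d∣2^k)

  odd⇒coprime-2^ : ∀ q t → ¬ 2 ∣ q → Coprime q (2 ^ t)
  odd⇒coprime-2^ q t ¬2∣q {e} (e∣q , e∣2^t) with ∣2^k⇒≡1⊎even t e e∣2^t
  ... | inj₁ e≡1 = e≡1
  ... | inj₂ 2∣e = ⊥-elim (¬2∣q (∣-trans 2∣e e∣q))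

  xor1 : ℕ → ℕ
  xor1 zero          = 1
  xor1 (suc zero)    = 0
  xor1 (suc (suc k)) = suc (suc (xor1 k))

  xor1-involutive : ∀ k → xor1 (xor1 k) ≡ k
  xor1-involutive zero          = refl
  xor1-involutive (suc zero)    = refl
  xor1-involutive (suc (suc k)) = cong (suc ∘ suc) (xor1-involutive k)

  xor1-≢ : ∀ k → xor1 k ≢ k
  xor1-≢ zero          ()
  xor1-≢ (suc zero)    ()
  xor1-≢ (suc (suc k)) e = xor1-≢ k (suc-injective (suc-injective e))

  xor1-< : ∀ k m → k < m → 2 ∣ m → xor1 k < m
  xor1-< k m k<m (divides q refl) = below-double k q k<m
    where
    below-double : ∀ k q → k < q * 2 → xor1 k < q * 2
    below-double (suc (suc k)) (suc q) (s≤s (s≤s k<)) = s≤s (s≤s (below-double k q k<))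
    below-double zero          (suc q) _ = s≤s (s≤s z≤n)
    below-double (suc zero)    (suc q) _ = s≤s z≤n

module Groups (G : FiniteGroup) where

  open import Level using (0ℓ)
  open import Data.Nat using (ℕ; zero; suc; _+_; _*_; _∸_; _^_; _≤_; _<_; s≤s; NonZero)
  open import Data.Nat.Properties
    using ( +-comm; +-suc; +-identityʳ; *-comm; *-assoc; suc-pred; ≤-refl; m≤n⇒m≤1+n; m≤n⇒∃[o]m+o≡n
          ; ^-distribˡ-+-*; ≤-total; m≤n+m; ≤-trans)
  open import Data.Nat.Divisibility using (_∣_; divides; _∣?_; 1∣_; n∣m⇒m%n≡0)
  open NatFacts using (odd⇒coprime-2^)
  open import Data.Empty using (⊥-elim)
  open import Relation.Nullary using (yes; no)
  open import Data.Nat.DivMod using (_%_; _/_; m≡m%n+[m/n]*n; m<n⇒m%n≡m)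
  open import Data.Nat.Coprimality using (Coprime; coprime-Bézout)
  open import Data.Nat.GCD using (module Bézout)
  open import Data.Product using (Σ; _,_; proj₁; proj₂)
  open import Data.Sum using (inj₁; inj₂)
  open import Relation.Binary.PropositionalEquality
  open import Algebra.Bundles using (Group)
  open import Algebra.Structures using (IsGroup)

  open FiniteGroup G public
  open IsGroup isGroup public using (assoc; identityˡ; identityʳ; inverseˡ; inverseʳ)
  open ≡-Reasoning

  group : Group 0ℓ 0ℓ
  group = record { Carrier = Carrier ; _≈_ = _≡_ ; _∙_ = _∙_ ; ε = ε ; _⁻¹ = _⁻¹ ; isGroup = isGroup }

  open import Algebra.Properties.Group group public
    using ( ∙-cancelˡ; ∙-cancelʳ; inverseʳ-unique; ⁻¹-involutive; ⁻¹-anti-homo-∙; ε⁻¹≈ε; x≈z//y; y≈x\\z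
          ; \\-leftDividesˡ; \\-leftDividesʳ; //-rightDividesˡ; //-rightDividesʳ)

  cancel-middle : ∀ a b c → a ∙ b ⁻¹ ∙ (b ∙ c) ≡ a ∙ c
  cancel-middle a b c = begin
    a ∙ b ⁻¹ ∙ (b ∙ c)  ≡⟨ assoc a (b ⁻¹) (b ∙ c) ⟩
    a ∙ (b ⁻¹ ∙ (b ∙ c)) ≡⟨ cong (a ∙_) (sym (assoc (b ⁻¹) b c)) ⟩
    a ∙ (b ⁻¹ ∙ b ∙ c)   ≡⟨ cong (λ u → a ∙ (u ∙ c)) (inverseˡ b) ⟩
    a ∙ (ε ∙ c)          ≡⟨ cong (a ∙_) (identityˡ c) ⟩
    a ∙ c                ∎

  cancel-middle⁻¹ : ∀ a b c → a ∙ b ∙ (b ⁻¹ ∙ c) ≡ a ∙ c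
  cancel-middle⁻¹ a b c = trans (cong (λ u → a ∙ u ∙ (b ⁻¹ ∙ c)) (sym (⁻¹-involutive b))) (cancel-middle a (b ⁻¹) c)

  interchange : ∀ p q r s → q ∙ r ≡ r ∙ q → p ∙ q ∙ (r ∙ s) ≡ p ∙ r ∙ (q ∙ s)
  interchange p q r s qr≡rq = begin
    p ∙ q ∙ (r ∙ s)   ≡⟨ assoc p q (r ∙ s) ⟩
    p ∙ (q ∙ (r ∙ s)) ≡⟨ cong (p ∙_) (sym (assoc q r s)) ⟩
    p ∙ (q ∙ r ∙ s)   ≡⟨ cong (λ u → p ∙ (u ∙ s)) qr≡rq ⟩
    p ∙ (r ∙ q ∙ s)   ≡⟨ cong (p ∙_) (assoc r q s) ⟩
    p ∙ (r ∙ (q ∙ s)) ≡⟨ sym (assoc p r (q ∙ s)) ⟩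
    p ∙ r ∙ (q ∙ s)   ∎

  pow-+ : ∀ g i j → pow g (i + j) ≡ pow g i ∙ pow g j
  pow-+ g zero    j = sym (identityˡ _)
  pow-+ g (suc i) j = trans (cong (g ∙_) (pow-+ g i j)) (sym (assoc _ _ _))

  pow-ε : ∀ k → pow ε k ≡ ε
  pow-ε zero    = refl
  pow-ε (suc k) = trans (identityˡ _) (pow-ε k)

  pow-* : ∀ g i j → pow g (i * j) ≡ pow (pow g j) i
  pow-* g zero    j = refl
  pow-* g (suc i) j = trans (pow-+ g j (i * j)) (cong (pow g j ∙_) (pow-* g i j))

  pow-*ˡ : ∀ g i j → pow g (i * j) ≡ pow (pow g i) j
  pow-*ˡ g i j = trans (cong (pow g) (*-comm i j)) (pow-* g j i)

  pow-sucʳ : ∀ g i → pow g (suc i) ≡ pow g i ∙ g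
  pow-sucʳ g i = trans (cong (pow g) (+-comm 1 i)) (trans (pow-+ g i 1) (cong (pow g i ∙_) (identityʳ g)))

  pow-⁻¹ : ∀ g i → pow g i ⁻¹ ≡ pow (g ⁻¹) i
  pow-⁻¹ g zero    = ε⁻¹≈ε
  pow-⁻¹ g (suc i) = trans (⁻¹-anti-homo-∙ g (pow g i))
    (trans (cong (_∙ g ⁻¹) (pow-⁻¹ g i)) (sym (pow-sucʳ (g ⁻¹) i)))

  pow-2 : ∀ g → pow g 2 ≡ g ∙ g
  pow-2 g = cong (g ∙_) (identityʳ g)

  pow-∙-comm : ∀ g h → g ∙ h ≡ h ∙ g → ∀ k → pow (g ∙ h) k ≡ pow g k ∙ pow h k
  pow-∙-comm g h gh≡hg zero    = sym (identityˡ ε)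
  pow-∙-comm g h gh≡hg (suc k) = begin
    g ∙ h ∙ pow (g ∙ h) k       ≡⟨ cong (g ∙ h ∙_) (pow-∙-comm g h gh≡hg k) ⟩
    g ∙ h ∙ (pow g k ∙ pow h k) ≡⟨ interchange g h (pow g k) (pow h k) (h-comm k) ⟩
    g ∙ pow g k ∙ (h ∙ pow h k) ∎
    where
    h-comm : ∀ k → h ∙ pow g k ≡ pow g k ∙ h
    h-comm zero    = trans (identityʳ h) (sym (identityˡ h))
    h-comm (suc k) = begin
      h ∙ (g ∙ pow g k) ≡⟨ sym (assoc h g _) ⟩
      h ∙ g ∙ pow g k   ≡⟨ cong (_∙ pow g k) (sym gh≡hg) ⟩
      g ∙ h ∙ pow g k   ≡⟨ assoc g h _ ⟩
      g ∙ (h ∙ pow g k) ≡⟨ cong (g ∙_) (h-comm k) ⟩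
      g ∙ (pow g k ∙ h) ≡⟨ sym (assoc g _ h) ⟩
      g ∙ pow g k ∙ h   ∎

  pow-vanish : ∀ g i p → pow g p ≡ ε → pow g (i * p) ≡ ε
  pow-vanish g i p g^p≡ε = trans (pow-* g i p) (trans (cong (λ u → pow u i) g^p≡ε) (pow-ε i))

  pow-bezout : ∀ g i j p q → pow g p ≡ ε → pow g q ≡ ε → 1 + j * q ≡ i * p → g ≡ ε
  pow-bezout g i j p q g^p≡ε g^q≡ε e = begin
    g                  ≡⟨ sym (identityʳ g) ⟩
    g ∙ ε              ≡⟨ cong (g ∙_) (sym (pow-vanish g j q g^q≡ε)) ⟩
    pow g (1 + j * q)  ≡⟨ cong (pow g) e ⟩
    pow g (i * p)      ≡⟨ pow-vanish g i p g^p≡ε ⟩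
    ε                  ∎

  pow-coprime : ∀ g p q → pow g p ≡ ε → pow g q ≡ ε → Coprime p q → g ≡ ε
  pow-coprime g p q g^p≡ε g^q≡ε p⊥q with coprime-Bézout p⊥q
  ... | Bézout.+- i j 1+jq≡ip = pow-bezout g i j p q g^p≡ε g^q≡ε 1+jq≡ip
  ... | Bézout.-+ i j 1+ip≡jq = pow-bezout g j i q p g^q≡ε g^p≡ε 1+ip≡jq

  pow-2^-+ : ∀ g j t → pow g (2 ^ (j + t)) ≡ pow (pow g (2 ^ j)) (2 ^ t)
  pow-2^-+ g j t = trans (cong (pow g) (^-distribˡ-+-* 2 j t)) (pow-*ˡ g (2 ^ j) (2 ^ t))

  pow-odd-2^ : ∀ z q t → ¬ 2 ∣ q → pow z q ≡ ε → pow z (2 ^ t) ≡ ε → z ≡ ε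
  pow-odd-2^ z q t ¬2∣q z^q≡ε z^2^t≡ε = pow-coprime z q (2 ^ t) z^q≡ε z^2^t≡ε (odd⇒coprime-2^ q t ¬2∣q)

  pow≡ε⇒2^[1+k]∣ : ∀ g k → pow g (2 ^ suc k) ≡ ε → pow g (2 ^ k) ≢ ε → ∀ a → pow g a ≡ ε → 2 ^ suc k ∣ a
  pow≡ε⇒2^[1+k]∣ g k g^2^[1+k]≡ε g^2^k≢ε a g^a≡ε = 2^j∣a (suc k) ≤-refl
    where
    2^j∣a : ∀ j → j ≤ suc k → 2 ^ j ∣ a
    2^j∣a zero    _         = 1∣ a
    2^j∣a (suc j) (s≤s j≤k) with 2^j∣a j (m≤n⇒m≤1+n j≤k)
    ... | divides q refl with 2 ∣? q
    ...   | yes (divides q′ refl) = divides q′ (*-assoc q′ 2 (2 ^ j))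
    ...   | no ¬2∣q = ⊥-elim (g^2^k≢ε (begin
            pow g (2 ^ k)        ≡⟨ cong (λ i → pow g (2 ^ i)) (sym j+t≡k) ⟩
            pow g (2 ^ (j + t))  ≡⟨ pow-2^-+ g j t ⟩
            pow z (2 ^ t)        ≡⟨ cong (λ u → pow u (2 ^ t)) z≡ε ⟩
            pow ε (2 ^ t)        ≡⟨ pow-ε (2 ^ t) ⟩
            ε                    ∎))
      where
      t = proj₁ (m≤n⇒∃[o]m+o≡n j≤k)
      j+t≡k = proj₂ (m≤n⇒∃[o]m+o≡n j≤k)
      z = pow g (2 ^ j)
      z≡ε : z ≡ ε
      z≡ε = pow-odd-2^ z q (suc t) ¬2∣q (trans (sym (pow-* g q (2 ^ j))) g^a≡ε)
        (trans (sym (pow-2^-+ g j (suc t))) (trans (cong (λ i → pow g (2 ^ i)) (trans (+-suc j t) (cong suc j+t≡k))) g^2^[1+k]≡ε))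

  module _ (g : Carrier) (n : ℕ) .{{_ : NonZero n}} (order : ∀ a → pow g a ≡ ε → n ∣ a) where

    private
      pow-injective-≤ : ∀ i j → i ≤ j → j < n → pow g i ≡ pow g j → i ≡ j
      pow-injective-≤ i j i≤j j<n g^i≡g^j with m≤n⇒∃[o]m+o≡n i≤j
      ... | d , refl = sym (trans (cong (i +_) d≡0) (+-identityʳ i))
        where
        g^d≡ε : pow g d ≡ ε
        g^d≡ε = sym (∙-cancelˡ (pow g i) ε (pow g d) (trans (identityʳ _) (trans g^i≡g^j (pow-+ g i d))))
        d≡0 : d ≡ 0
        d≡0 = trans (sym (m<n⇒m%n≡m (≤-trans (s≤s (m≤n+m d i)) j<n))) (n∣m⇒m%n≡0 d n (order d g^d≡ε))

    pow-injective : ∀ i j → i < n → j < n → pow g i ≡ pow g j → i ≡ j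
    pow-injective i j i<n j<n g^i≡g^j with ≤-total i j
    ... | inj₁ i≤j = pow-injective-≤ i j i≤j j<n g^i≡g^j
    ... | inj₂ j≤i = sym (pow-injective-≤ j i j≤i i<n (sym g^i≡g^j))

  pow-order-⁻¹ : ∀ g n .{{_ : NonZero n}} → pow g n ≡ ε → g ⁻¹ ≡ pow g (n ∸ 1)
  pow-order-⁻¹ g n g^n≡ε = sym (inverseʳ-unique g (pow g (n ∸ 1)) (trans (cong (pow g) (suc-pred n)) g^n≡ε))

  pow-% : ∀ g n .{{_ : NonZero n}} → pow g n ≡ ε → ∀ i → pow g i ≡ pow g (i % n)
  pow-% g n g^n≡ε i = begin
    pow g i                            ≡⟨ cong (pow g) (m≡m%n+[m/n]*n i n) ⟩
    pow g (i % n + i / n * n)          ≡⟨ pow-+ g (i % n) (i / n * n) ⟩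
    pow g (i % n) ∙ pow g (i / n * n)  ≡⟨ cong (pow g (i % n) ∙_) (pow-vanish g (i / n) n g^n≡ε) ⟩
    pow g (i % n) ∙ ε                  ≡⟨ identityʳ _ ⟩
    pow g (i % n)                      ∎

  ˆ-∙ : ∀ g h b → (g ∙ h) ˆ b ≡ g ˆ b ∙ h ˆ b
  ˆ-∙ g h b = sym (begin
    b ⁻¹ ∙ g ∙ b ∙ (b ⁻¹ ∙ h ∙ b)   ≡⟨ cong (b ⁻¹ ∙ g ∙ b ∙_) (assoc (b ⁻¹) h b) ⟩
    b ⁻¹ ∙ g ∙ b ∙ (b ⁻¹ ∙ (h ∙ b)) ≡⟨ cancel-middle⁻¹ (b ⁻¹ ∙ g) b (h ∙ b) ⟩
    b ⁻¹ ∙ g ∙ (h ∙ b)              ≡⟨ sym (assoc _ h b) ⟩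
    b ⁻¹ ∙ g ∙ h ∙ b                ≡⟨ cong (_∙ b) (assoc (b ⁻¹) g h) ⟩
    b ⁻¹ ∙ (g ∙ h) ∙ b              ∎)

  ˆ-ε : ∀ b → ε ˆ b ≡ ε
  ˆ-ε b = trans (cong (_∙ b) (identityʳ (b ⁻¹))) (inverseˡ b)

  ˆ-⁻¹ : ∀ g b → (g ⁻¹) ˆ b ≡ (g ˆ b) ⁻¹
  ˆ-⁻¹ g b = inverseʳ-unique (g ˆ b) ((g ⁻¹) ˆ b)
    (trans (sym (ˆ-∙ g (g ⁻¹) b)) (trans (cong (_ˆ b) (inverseʳ g)) (ˆ-ε b)))

  ˆ-pow : ∀ g k b → pow g k ˆ b ≡ pow (g ˆ b) k
  ˆ-pow g zero    b = ˆ-ε b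
  ˆ-pow g (suc k) b = trans (ˆ-∙ g (pow g k) b) (cong (g ˆ b ∙_) (ˆ-pow g k b))

  ˆ-ˆ : ∀ g a b → (g ˆ a) ˆ b ≡ g ˆ (a ∙ b)
  ˆ-ˆ g a b = begin
    b ⁻¹ ∙ (a ⁻¹ ∙ g ∙ a) ∙ b   ≡⟨ cong (_∙ b) (sym (assoc (b ⁻¹) (a ⁻¹ ∙ g) a)) ⟩
    b ⁻¹ ∙ (a ⁻¹ ∙ g) ∙ a ∙ b   ≡⟨ assoc _ a b ⟩
    b ⁻¹ ∙ (a ⁻¹ ∙ g) ∙ (a ∙ b) ≡⟨ cong (_∙ (a ∙ b)) (sym (assoc (b ⁻¹) (a ⁻¹) g)) ⟩
    b ⁻¹ ∙ a ⁻¹ ∙ g ∙ (a ∙ b)   ≡⟨ cong (λ u → u ∙ g ∙ (a ∙ b)) (sym (⁻¹-anti-homo-∙ a b)) ⟩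
    (a ∙ b) ⁻¹ ∙ g ∙ (a ∙ b)    ∎

  ˆ-identity : ∀ g → g ˆ ε ≡ g
  ˆ-identity g = trans (cong (λ u → u ∙ g ∙ ε) ε⁻¹≈ε) (trans (identityʳ _) (identityˡ g))

  ˆ-ˆ-⁻¹ : ∀ g b → (g ˆ b) ˆ (b ⁻¹) ≡ g
  ˆ-ˆ-⁻¹ g b = trans (ˆ-ˆ g b (b ⁻¹)) (trans (cong (g ˆ_) (inverseʳ b)) (ˆ-identity g))

  ˆ-⁻¹-ˆ : ∀ g b → (g ˆ (b ⁻¹)) ˆ b ≡ g
  ˆ-⁻¹-ˆ g b = trans (ˆ-ˆ g (b ⁻¹) b) (trans (cong (g ˆ_) (inverseˡ b)) (ˆ-identity g))

  ˆ-comm : ∀ g b → g ∙ b ≡ b ∙ g → g ˆ b ≡ g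
  ˆ-comm g b gb≡bg = trans (assoc (b ⁻¹) g b) (trans (cong (b ⁻¹ ∙_) gb≡bg) (\\-leftDividesʳ b g))

  ˆ-injective : ∀ g h b → g ˆ b ≡ h ˆ b → g ≡ h
  ˆ-injective g h b e = trans (sym (ˆ-ˆ-⁻¹ g b)) (trans (cong (_ˆ (b ⁻¹)) e) (ˆ-ˆ-⁻¹ h b))

  ∙-ˆ : ∀ g b → b ∙ g ˆ b ≡ g ∙ b
  ∙-ˆ g b = begin
    b ∙ (b ⁻¹ ∙ g ∙ b)   ≡⟨ cong (b ∙_) (assoc (b ⁻¹) g b) ⟩
    b ∙ (b ⁻¹ ∙ (g ∙ b)) ≡⟨ sym (assoc b (b ⁻¹) (g ∙ b)) ⟩
    b ∙ b ⁻¹ ∙ (g ∙ b)   ≡⟨ cong (_∙ (g ∙ b)) (inverseʳ b) ⟩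
    ε ∙ (g ∙ b)          ≡⟨ identityˡ (g ∙ b) ⟩
    g ∙ b                ∎

  ⟨⟩-pow : ∀ {X g} → ⟨ X ⟩ g → ∀ k → ⟨ X ⟩ (pow g k)
  ⟨⟩-pow p zero    = one
  ⟨⟩-pow p (suc k) = mul p (⟨⟩-pow p k)

  ⟨⟩-cancelˡ : ∀ {X g h} → ⟨ X ⟩ (g ∙ h) → ⟨ X ⟩ g → ⟨ X ⟩ h
  ⟨⟩-cancelˡ {X} {g} {h} gh g∈ = subst ⟨ X ⟩ (trans (sym (assoc _ _ _)) (trans (cong (_∙ h) (inverseˡ g)) (identityˡ h)))
    (mul (inv g∈) gh)

  ⟨⟩-cancelʳ : ∀ {X g h} → ⟨ X ⟩ (g ∙ h) → ⟨ X ⟩ h → ⟨ X ⟩ g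
  ⟨⟩-cancelʳ {X} {g} {h} gh h∈ = subst ⟨ X ⟩ (trans (assoc _ _ _) (trans (cong (g ∙_) (inverseʳ h)) (identityʳ g)))
    (mul gh (inv h∈))

  commutes-with-⟨⟩ : ∀ {X w z} → (∀ {t} → X t → w ∙ t ≡ t ∙ w) → ⟨ X ⟩ z → w ∙ z ≡ z ∙ w
  commutes-with-⟨⟩ comm (gen t∈X) = comm t∈X
  commutes-with-⟨⟩ {w = w} comm one = trans (identityʳ w) (sym (identityˡ w))
  commutes-with-⟨⟩ {w = w} comm (mul {g} {h} g∈ h∈) = begin
    w ∙ (g ∙ h) ≡⟨ sym (assoc w g h) ⟩
    w ∙ g ∙ h   ≡⟨ cong (_∙ h) (commutes-with-⟨⟩ comm g∈) ⟩
    g ∙ w ∙ h   ≡⟨ assoc g w h ⟩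
    g ∙ (w ∙ h) ≡⟨ cong (g ∙_) (commutes-with-⟨⟩ comm h∈) ⟩
    g ∙ (h ∙ w) ≡⟨ sym (assoc g h w) ⟩
    g ∙ h ∙ w   ∎
  commutes-with-⟨⟩ {w = w} comm (inv {g} g∈) = begin
    w ∙ g ⁻¹               ≡⟨ sym (identityˡ _) ⟩
    ε ∙ (w ∙ g ⁻¹)         ≡⟨ cong (_∙ (w ∙ g ⁻¹)) (sym (inverseˡ g)) ⟩
    g ⁻¹ ∙ g ∙ (w ∙ g ⁻¹)  ≡⟨ interchange (g ⁻¹) g w (g ⁻¹) (sym (commutes-with-⟨⟩ comm g∈)) ⟩
    g ⁻¹ ∙ w ∙ (g ∙ g ⁻¹)  ≡⟨ cong (g ⁻¹ ∙ w ∙_) (inverseʳ g) ⟩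
    g ⁻¹ ∙ w ∙ ε           ≡⟨ identityʳ _ ⟩
    g ⁻¹ ∙ w               ∎

  cyclic-comm : ∀ {g z w} → ⟨ g ⟩₁ z → ⟨ g ⟩₁ w → z ∙ w ≡ w ∙ z
  cyclic-comm z∈ w∈ = commutes-with-⟨⟩ (λ { refl → sym (commutes-with-⟨⟩ (λ { refl → refl }) z∈) }) w∈

  cyclic-pow : ∀ {g z} n .{{_ : NonZero n}} → pow g n ≡ ε → ⟨ g ⟩₁ z → Σ ℕ λ i → z ≡ pow g i
  cyclic-pow {g} n g^n≡ε (gen refl) = 1 , sym (identityʳ g)
  cyclic-pow n g^n≡ε one = 0 , refl
  cyclic-pow {g} n g^n≡ε (mul z∈ w∈) with cyclic-pow n g^n≡ε z∈ | cyclic-pow n g^n≡ε w∈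
  ... | i , refl | j , refl = i + j , sym (pow-+ g i j)
  cyclic-pow {g} n g^n≡ε (inv z∈) with cyclic-pow n g^n≡ε z∈
  ... | i , refl = (n ∸ 1) * i , (begin
    pow g i ⁻¹             ≡⟨ pow-⁻¹ g i ⟩
    pow (g ⁻¹) i           ≡⟨ cong (λ u → pow u i) (pow-order-⁻¹ g n g^n≡ε) ⟩
    pow (pow g (n ∸ 1)) i  ≡⟨ sym (pow-*ˡ g (n ∸ 1) i) ⟩
    pow g ((n ∸ 1) * i)    ∎)

module _ (G : FiniteGroup) where

  open Groups G

  module PerfectCodeCriterion (H : Carrier → Set) (H? : Decidable H)
    (H-ε : H ε) (H-∙ : ∀ {g h} → H g → H h → H (g ∙ h)) (H-⁻¹ : ∀ {g} → H g → H (g ⁻¹)) where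

    open Counting
    open NatFacts
    open import Data.Nat using (ℕ; _*_; _^_; _<_; _≤_; _≟_; _<?_; NonZero)
    open import Data.Nat.Properties using (≤-reflexive; <-irrefl; ≤-trans; <-asym; ≮⇒≥; ≤∧≢⇒<; *-cancelˡ-≡; m^n≢0)
    open import Data.Nat.Divisibility using (_∣_; divides)
    open import Data.Bool using (Bool; true; _∧_; T; not)
    open import Data.Fin using (toℕ)
    open import Data.Fin.Properties using (any?; toℕ-injective) renaming (_≟_ to _≟ᶠ_)
    open import Data.Fin.Subset using (Subset; _∈_; _∉_)
    open import Data.Vec using (tabulate)
    open import Data.Vec.Properties using (lookup∘tabulate; []=⇒lookup; lookup⇒[]=)
    open import Data.Product using (Σ; _×_; _,_; proj₁; proj₂)
    open import Data.Sum using (_⊎_; inj₁; inj₂)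
    open import Data.Empty using (⊥-elim)
    open import Data.Unit using (tt)
    open import Relation.Nullary using (¬_; Dec; yes; no)
    open import Relation.Nullary.Decidable using (⌊_⌋; toWitness; fromWitness; toWitnessFalse; fromWitnessFalse; _×-dec_)
    open import Relation.Binary.PropositionalEquality
    open import Function.Bundles using (mk⇔)

    inH : Carrier → Bool
    inH g = ⌊ H? g ⌋

    inH⇒H : ∀ {g} → T (inH g) → H g
    inH⇒H = toWitness

    H⇒inH : ∀ {g} → H g → T (inH g)
    H⇒inH = fromWitness

    ∣H∣ : ℕ
    ∣H∣ = count inH

    H-⁻¹⁻ : ∀ {g} → H (g ⁻¹) → H g
    H-⁻¹⁻ g⁻¹∈H = subst H (⁻¹-involutive _) (H-⁻¹ g⁻¹∈H)

    infix 4 _~_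
    _~_ : Carrier → Carrier → Set
    g ~ t = H (g ∙ t ⁻¹)

    ~-refl : ∀ g → g ~ g
    ~-refl g = subst H (sym (inverseʳ g)) H-ε

    ~-sym : ∀ {g t} → g ~ t → t ~ g
    ~-sym {g} {t} g~t = subst H (trans (⁻¹-anti-homo-∙ g (t ⁻¹)) (cong (_∙ g ⁻¹) (⁻¹-involutive t))) (H-⁻¹ g~t)

    ~-trans : ∀ {g t u} → g ~ t → t ~ u → g ~ u
    ~-trans {g} {t} {u} g~t t~u = subst H (cancel-middle g t (u ⁻¹)) (H-∙ g~t t~u)

    ~-left : ∀ {h g} → H h → h ∙ g ~ g
    ~-left {h} {g} h∈H = subst H (sym (//-rightDividesʳ g h)) h∈H

    ~-right : ∀ {t u} k → t ~ u → t ∙ k ~ u ∙ k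
    ~-right {t} {u} k t~u = subst H (sym (begin
      t ∙ k ∙ (u ∙ k) ⁻¹      ≡⟨ cong (t ∙ k ∙_) (⁻¹-anti-homo-∙ u k) ⟩
      t ∙ k ∙ (k ⁻¹ ∙ u ⁻¹)   ≡⟨ cancel-middle⁻¹ t k (u ⁻¹) ⟩
      t ∙ u ⁻¹                ∎)) t~u
      where open ≡-Reasoning

    ~-H : ∀ {g t} → g ~ t → H t → H g
    ~-H {g} {t} g~t t∈H = subst H (//-rightDividesˡ t g) (H-∙ g~t t∈H)

    rep : Carrier → Carrier
    rep g = first ε (λ t → inH (g ∙ t ⁻¹))

    rep-~ : ∀ g → g ~ rep g
    rep-~ g = inH⇒H (first-satisfies ε (λ t → inH (g ∙ t ⁻¹)) g (H⇒inH (~-refl g)))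

    rep-cong : ∀ {g g′} → g ~ g′ → rep g ≡ rep g′
    rep-cong g~g′ = first-cong ε λ t →
      ⌊⌋-⇔ (mk⇔ (~-trans (~-sym g~g′)) (~-trans g~g′)) (H? _) (H? _)

    rep-≡⇒~ : ∀ {g g′} → rep g ≡ rep g′ → g ~ g′
    rep-≡⇒~ {g} {g′} e = ~-trans (rep-~ g) (subst (_~ g′) (sym e) (~-sym (rep-~ g′)))

    rep-idem : ∀ g → rep (rep g) ≡ rep g
    rep-idem g = rep-cong (~-sym (rep-~ g))

    rep-∉H : ∀ {g} → ¬ H g → ¬ H (rep g)
    rep-∉H {g} g∉H rep∈H = g∉H (~-H (rep-~ g) rep∈H)

    -- Double g t holds iff t ∈ H g H.
    Double : Carrier → Carrier → Set
    Double g t = Σ Carrier λ k → H k × t ~ g ∙ k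

    double? : ∀ g t → Dec (Double g t)
    double? g t = any? λ k → H? k ×-dec H? (t ∙ (g ∙ k) ⁻¹)

    inDouble : Carrier → Carrier → Bool
    inDouble g t = ⌊ double? g t ⌋

    double-refl : ∀ g → Double g g
    double-refl g = ε , H-ε , subst (g ~_) (sym (identityʳ g)) (~-refl g)

    double-~ : ∀ {g t t′} → t′ ~ t → Double g t → Double g t′
    double-~ t′~t (k , k∈H , t~gk) = k , k∈H , ~-trans t′~t t~gk

    double-∙ʳ : ∀ {g t k} → H k → Double g t → Double g (t ∙ k)
    double-∙ʳ {g} {t} {k} k∈H (k′ , k′∈H , t~gk′) =
      k′ ∙ k , H-∙ k′∈H k∈H , subst (t ∙ k ~_) (assoc g k′ k) (~-right k t~gk′)

    double-trans : ∀ {g t u} → Double g t → Double t u → Double g u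
    double-trans g⇝t (k , k∈H , u~tk) = double-~ u~tk (double-∙ʳ k∈H g⇝t)

    double-sym : ∀ {g t} → Double g t → Double t g
    double-sym {g} {t} (k , k∈H , t~gk) =
      k ⁻¹ , H-⁻¹ k∈H , subst (_~ t ∙ k ⁻¹) (//-rightDividesʳ k g) (~-right (k ⁻¹) (~-sym t~gk))

    double-⁻¹ : ∀ {g t} → Double g t → Double (g ⁻¹) (t ⁻¹)
    double-⁻¹ {g} {t} (k , k∈H , t~gk) =
      (t ∙ (g ∙ k) ⁻¹) ⁻¹ , H-⁻¹ t~gk , subst (t ⁻¹ ~_) (sym g⁻¹h⁻¹≡kt⁻¹) (~-sym (~-left k∈H))
      where
      open ≡-Reasoning
      g⁻¹h⁻¹≡kt⁻¹ : g ⁻¹ ∙ (t ∙ (g ∙ k) ⁻¹) ⁻¹ ≡ k ∙ t ⁻¹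
      g⁻¹h⁻¹≡kt⁻¹ = begin
        g ⁻¹ ∙ (t ∙ (g ∙ k) ⁻¹) ⁻¹        ≡⟨ cong (g ⁻¹ ∙_) (⁻¹-anti-homo-∙ t _) ⟩
        g ⁻¹ ∙ ((g ∙ k) ⁻¹ ⁻¹ ∙ t ⁻¹)     ≡⟨ cong (λ u → g ⁻¹ ∙ (u ∙ t ⁻¹)) (⁻¹-involutive (g ∙ k)) ⟩
        g ⁻¹ ∙ (g ∙ k ∙ t ⁻¹)             ≡⟨ cong (g ⁻¹ ∙_) (assoc g k (t ⁻¹)) ⟩
        g ⁻¹ ∙ (g ∙ (k ∙ t ⁻¹))           ≡⟨ \\-leftDividesʳ g (k ∙ t ⁻¹) ⟩
        k ∙ t ⁻¹                          ∎

    double-⁻¹′ : ∀ {g t} → Double (g ⁻¹) t → Double g (t ⁻¹)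
    double-⁻¹′ {g} g⁻¹⇝t = subst (λ u → Double u _) (⁻¹-involutive g) (double-⁻¹ g⁻¹⇝t)

    inDouble-cong : ∀ {g t} → Double g t → ∀ u → inDouble g u ≡ inDouble t u
    inDouble-cong g⇝t u =
      ⌊⌋-⇔ (mk⇔ (double-trans (double-sym g⇝t)) (double-trans g⇝t)) (double? _ u) (double? _ u)

    repIn : Carrier → Carrier → Bool
    repIn g r = (rep r == r) ∧ inDouble g r

    cosets : Carrier → ℕ
    cosets g = count (repIn g)

    repIn-intro : ∀ {g r} → rep r ≡ r → Double g r → T (repIn g r)
    repIn-intro {g} {r} r-rep g⇝r = T-∧-intro {rep r == r} (fromWitness r-rep) (fromWitness g⇝r)

    repIn-rep : ∀ {g r} → T (repIn g r) → rep r ≡ r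
    repIn-rep {g} {r} t = toWitness (T-∧-proj₁ {rep r == r} t)

    repIn-double : ∀ {g r} → T (repIn g r) → Double g r
    repIn-double {g} {r} t = toWitness (T-∧-proj₂ {rep r == r} t)

    repIn-of-rep : ∀ {g t} → Double g t → T (repIn g (rep t))
    repIn-of-rep {t = t} g⇝t = repIn-intro (rep-idem t) (double-~ (~-sym (rep-~ t)) g⇝t)

    repIn-cong : ∀ {g t} → Double g t → ∀ r → repIn g r ≡ repIn t r
    repIn-cong g⇝t r = cong ((rep r == r) ∧_) (inDouble-cong g⇝t r)

    cosets-cong : ∀ {g t} → Double g t → cosets g ≡ cosets t
    cosets-cong g⇝t = count-cong (repIn-cong g⇝t)

    ∣HgH∣≡∣H∣*cosets : ∀ g → count (inDouble g) ≡ ∣H∣ * cosets g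
    ∣HgH∣≡∣H∣*cosets g = count-fibres (inDouble g) (repIn g) rep ∣H∣ (λ t t∈ → repIn-of-rep (toWitness t∈)) fibre≡H
      where
      fibre≡H : ∀ r → T (repIn g r) → count (fibre (inDouble g) rep r) ≡ ∣H∣
      fibre≡H r r∈ = count-bijection _ inH (λ t → t ∙ r ⁻¹) (λ h → h ∙ r)
        (λ t t∈ → H⇒inH (rep-≡⇒~ (trans (toWitness (T-∧-proj₂ {inDouble g t} t∈)) (sym (repIn-rep r∈)))))
        (λ h h∈ → T-∧-intro {inDouble g (h ∙ r)} (fromWitness (double-~ (~-left (inH⇒H h∈)) (repIn-double r∈)))
                            (fromWitness (trans (rep-cong (~-left (inH⇒H h∈))) (repIn-rep r∈))))
        (λ t _ → //-rightDividesˡ r t)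
        (λ h _ → //-rightDividesʳ r h)

    ∣HgH∣≡∣Hg⁻¹H∣ : ∀ g → count (inDouble g) ≡ count (inDouble (g ⁻¹))
    ∣HgH∣≡∣Hg⁻¹H∣ g = count-bijection (inDouble g) (inDouble (g ⁻¹)) _⁻¹ _⁻¹
      (λ t t∈ → fromWitness (double-⁻¹ (toWitness t∈)))
      (λ t t∈ → fromWitness (double-⁻¹′ (toWitness t∈)))
      (λ t _ → ⁻¹-involutive t)
      (λ t _ → ⁻¹-involutive t)

    -- The stabiliser of the coset H g under right multiplication by H.
    stabiliser : Carrier → Carrier → Bool
    stabiliser g k = inH k ∧ inH (g ∙ k ∙ g ⁻¹)

    ∣H∣≡∣stabiliser∣*cosets : ∀ g → ∣H∣ ≡ count (stabiliser g) * cosets g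
    ∣H∣≡∣stabiliser∣*cosets g =
      count-fibres inH (repIn g) (λ k → rep (g ∙ k)) (count (stabiliser g)) gk∈ fibre≡stabiliser
      where
      open ≡-Reasoning
      g⇝gk : ∀ {k} → H k → Double g (g ∙ k)
      g⇝gk {k} k∈H = k , k∈H , ~-refl (g ∙ k)
      gk∈ : ∀ k → T (inH k) → T (repIn g (rep (g ∙ k)))
      gk∈ k k∈ = repIn-of-rep (g⇝gk (inH⇒H k∈))
      fibre≡stabiliser : ∀ r → T (repIn g r) → count (fibre inH (λ k → rep (g ∙ k)) r) ≡ count (stabiliser g)
      fibre≡stabiliser r r∈ with repIn-double r∈
      ... | k₀ , k₀∈H , r~gk₀ = count-bijection _ (stabiliser g) (λ k → k ∙ k₀ ⁻¹) (λ k → k ∙ k₀) to from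
        (λ k _ → //-rightDividesˡ k₀ k) (λ k _ → //-rightDividesʳ k₀ k)
        where
        conj-shift : ∀ k → g ∙ k ∙ (g ∙ k₀) ⁻¹ ≡ g ∙ (k ∙ k₀ ⁻¹) ∙ g ⁻¹
        conj-shift k = begin
          g ∙ k ∙ (g ∙ k₀) ⁻¹       ≡⟨ cong (g ∙ k ∙_) (⁻¹-anti-homo-∙ g k₀) ⟩
          g ∙ k ∙ (k₀ ⁻¹ ∙ g ⁻¹)    ≡⟨ sym (assoc _ (k₀ ⁻¹) (g ⁻¹)) ⟩
          g ∙ k ∙ k₀ ⁻¹ ∙ g ⁻¹      ≡⟨ cong (_∙ g ⁻¹) (assoc g k (k₀ ⁻¹)) ⟩
          g ∙ (k ∙ k₀ ⁻¹) ∙ g ⁻¹    ∎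
        to : ∀ k → T (inH k ∧ (rep (g ∙ k) == r)) → T (stabiliser g (k ∙ k₀ ⁻¹))
        to k k∈ = T-∧-intro (H⇒inH (H-∙ (inH⇒H (T-∧-proj₁ k∈)) (H-⁻¹ k₀∈H)))
          (H⇒inH (subst H (conj-shift k)
            (~-trans (rep-≡⇒~ (trans (toWitness (T-∧-proj₂ {inH k} k∈)) (sym (repIn-rep r∈)))) r~gk₀)))
        from : ∀ k → T (stabiliser g k) → T (inH (k ∙ k₀) ∧ (rep (g ∙ (k ∙ k₀)) == r))
        from k k∈ = T-∧-intro (H⇒inH (H-∙ (inH⇒H (T-∧-proj₁ k∈)) k₀∈H))
          (fromWitness (trans (rep-cong gkk₀~r) (repIn-rep r∈)))
          where
          gkk₀~r : g ∙ (k ∙ k₀) ~ r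
          gkk₀~r = ~-trans (subst H (sym (trans (conj-shift (k ∙ k₀)) (cong (λ u → g ∙ u ∙ g ⁻¹) (//-rightDividesʳ k₀ k))))
                             (inH⇒H (T-∧-proj₂ {inH k} k∈)))
                           (~-sym r~gk₀)

    cosets≡1⇒~ : ∀ {g t} → cosets g ≡ 1 → Double g t → t ~ g
    cosets≡1⇒~ {g} {t} single g⇝t with rep t ≟ᶠ rep g
    ... | yes rep-t≡rep-g = rep-≡⇒~ rep-t≡rep-g
    ... | no  rep-t≢rep-g = ⊥-elim (<-irrefl refl (≤-trans
            (2≤count (repIn g) _ _ (repIn-of-rep g⇝t) (repIn-of-rep (double-refl g)) rep-t≢rep-g)
            (≤-reflexive single)))

    cosets≡1⇒conj : ∀ {g h} → cosets g ≡ 1 → H h → H (h ˆ (g ⁻¹))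
    cosets≡1⇒conj {g} {h} single h∈H = subst H (cong (λ u → u ∙ h ∙ g ⁻¹) (sym (⁻¹-involutive g)))
      (cosets≡1⇒~ single (h , h∈H , ~-refl (g ∙ h)))

    module TwoPowerOrder (k : ℕ) (∣H∣≡2^k : ∣H∣ ≡ 2 ^ k) where

      instance
        ∣H∣≢0 : NonZero ∣H∣
        ∣H∣≢0 = subst NonZero (sym ∣H∣≡2^k) (m^n≢0 2 k)

      cosets≡1⊎even : ∀ g → cosets g ≡ 1 ⊎ 2 ∣ cosets g
      cosets≡1⊎even g = ∣2^k⇒≡1⊎even k (cosets g)
        (divides (count (stabiliser g)) (trans (sym ∣H∣≡2^k) (∣H∣≡∣stabiliser∣*cosets g)))

      cosets-⁻¹ : ∀ g → cosets g ≡ cosets (g ⁻¹)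
      cosets-⁻¹ g = *-cancelˡ-≡ (cosets g) (cosets (g ⁻¹)) ∣H∣
        (trans (sym (∣HgH∣≡∣H∣*cosets g)) (trans (∣HgH∣≡∣Hg⁻¹H∣ g) (∣HgH∣≡∣H∣*cosets (g ⁻¹))))

      cosets≡1⇒normalizer : ∀ {a} → cosets a ≡ 1 → Normalizer H a
      cosets≡1⇒normalizer {a} single h =
        (λ h∈H → subst (λ u → H (h ˆ u)) (⁻¹-involutive a) (cosets≡1⇒conj (trans (sym (cosets-⁻¹ a)) single) h∈H)) ,
        (λ hᵃ∈H → subst H (ˆ-ˆ-⁻¹ h a) (cosets≡1⇒conj single hᵃ∈H))

      -- The partner of a representative r lies in H r⁻¹ H: it is r itself when H r H = H r = H r⁻¹ H,
      -- otherwise the representative of the same rank in H r⁻¹ H, or, if that double coset is H r H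
      -- (which then holds an even number of cosets), the one whose rank differs from r's in the last bit.
      partner : Carrier → Carrier
      partner r with double? r (r ⁻¹) | cosets r ≟ 1
      ... | yes _ | yes _ = r
      ... | yes _ | no _  = nth ε (repIn r) (xor1 (rank (repIn r) r))
      ... | no _  | _     = nth ε (repIn (r ⁻¹)) (rank (repIn r) r)

      partner-self : ∀ {r} → Double r (r ⁻¹) → cosets r ≡ 1 → partner r ≡ r
      partner-self {r} r⇝r⁻¹ single with double? r (r ⁻¹) | cosets r ≟ 1
      ... | yes _ | yes _        = refl
      ... | yes _ | no ¬single   = ⊥-elim (¬single single)
      ... | no ¬r⇝r⁻¹ | _        = ⊥-elim (¬r⇝r⁻¹ r⇝r⁻¹)

      partner-swap : ∀ {r} → Double r (r ⁻¹) → cosets r ≢ 1 →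
        partner r ≡ nth ε (repIn r) (xor1 (rank (repIn r) r))
      partner-swap {r} r⇝r⁻¹ ¬single with double? r (r ⁻¹) | cosets r ≟ 1
      ... | yes _ | yes single   = ⊥-elim (¬single single)
      ... | yes _ | no _         = refl
      ... | no ¬r⇝r⁻¹ | _        = ⊥-elim (¬r⇝r⁻¹ r⇝r⁻¹)

      partner-transfer : ∀ {r} → ¬ Double r (r ⁻¹) → partner r ≡ nth ε (repIn (r ⁻¹)) (rank (repIn r) r)
      partner-transfer {r} ¬r⇝r⁻¹ with double? r (r ⁻¹)
      ... | yes r⇝r⁻¹ = ⊥-elim (¬r⇝r⁻¹ r⇝r⁻¹)
      ... | no _      = refl

      record IsPartner (r r′ : Carrier) : Set where
        field
          rep-partner : rep r′ ≡ r′
          partner-in  : Double (r ⁻¹) r′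
          involutive  : partner r′ ≡ r
          fixed       : r′ ≡ r → cosets r ≡ 1 × Double r (r ⁻¹)

      private
        repIn-self : ∀ {r} → rep r ≡ r → T (repIn r r)
        repIn-self r-rep = repIn-intro r-rep (double-refl _)

        single-case : ∀ r → rep r ≡ r → Double r (r ⁻¹) → cosets r ≡ 1 → IsPartner r r
        single-case r r-rep r⇝r⁻¹ single = record
          { rep-partner = r-rep
          ; partner-in  = double-sym r⇝r⁻¹
          ; involutive  = partner-self r⇝r⁻¹ single
          ; fixed       = λ _ → single , r⇝r⁻¹ }

        swap-case : ∀ r → rep r ≡ r → Double r (r ⁻¹) → cosets r ≢ 1 →
          IsPartner r (nth ε (repIn r) (xor1 (rank (repIn r) r)))
        swap-case r r-rep r⇝r⁻¹ ¬single = record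
          { rep-partner = repIn-rep r′∈
          ; partner-in  = double-trans (double-sym r⇝r⁻¹) r⇝r′
          ; involutive  = begin
              partner r′                                          ≡⟨ partner-swap r′⇝r′⁻¹ ¬single′ ⟩
              nth ε (repIn r′) (xor1 (rank (repIn r′) r′))        ≡⟨ nth-cong ε same _ ⟩
              nth ε (repIn r) (xor1 (rank (repIn r′) r′))
                ≡⟨ cong (λ j → nth ε (repIn r) (xor1 j)) (trans (rank-cong same r′) rank-r′) ⟩
              nth ε (repIn r) (xor1 (xor1 (rank (repIn r) r)))    ≡⟨ cong (nth ε (repIn r)) (xor1-involutive _) ⟩
              nth ε (repIn r) (rank (repIn r) r)                  ≡⟨ nth-rank ε (repIn r) r (repIn-self r-rep) ⟩
              r                                                   ∎
          ; fixed       = λ r′≡r → ⊥-elim (xor1-≢ (rank (repIn r) r) (trans (sym rank-r′) (cong (rank (repIn r)) r′≡r))) }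
          where
          open ≡-Reasoning
          even : 2 ∣ cosets r
          even with cosets≡1⊎even r
          ... | inj₁ single = ⊥-elim (¬single single)
          ... | inj₂ 2∣     = 2∣
          r′ = nth ε (repIn r) (xor1 (rank (repIn r) r))
          spec = nth-satisfies ε (repIn r) (xor1 (rank (repIn r) r))
                   (xor1-< _ _ (rank<count (repIn r) r (repIn-self r-rep)) even)
          r′∈ = proj₁ spec
          rank-r′ = proj₂ spec
          r⇝r′ : Double r r′
          r⇝r′ = repIn-double r′∈
          same : ∀ t → repIn r′ t ≡ repIn r t
          same t = sym (repIn-cong r⇝r′ t)
          r′⇝r′⁻¹ : Double r′ (r′ ⁻¹)
          r′⇝r′⁻¹ = double-trans (double-sym r⇝r′) (double-trans r⇝r⁻¹ (double-⁻¹ r⇝r′))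
          ¬single′ : cosets r′ ≢ 1
          ¬single′ single = ¬single (trans (cosets-cong r⇝r′) single)

        transfer-case : ∀ r → rep r ≡ r → ¬ Double r (r ⁻¹) →
          IsPartner r (nth ε (repIn (r ⁻¹)) (rank (repIn r) r))
        transfer-case r r-rep ¬r⇝r⁻¹ = record
          { rep-partner = repIn-rep r′∈
          ; partner-in  = r⁻¹⇝r′
          ; involutive  = begin
              partner r′                                        ≡⟨ partner-transfer ¬r′⇝r′⁻¹ ⟩
              nth ε (repIn (r′ ⁻¹)) (rank (repIn r′) r′)        ≡⟨ nth-cong ε (λ t → sym (repIn-cong r⇝r′⁻¹ t)) _ ⟩
              nth ε (repIn r) (rank (repIn r′) r′)
                ≡⟨ cong (nth ε (repIn r)) (trans (rank-cong (λ t → sym (repIn-cong r⁻¹⇝r′ t)) r′) rank-r′) ⟩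
              nth ε (repIn r) (rank (repIn r) r)                ≡⟨ nth-rank ε (repIn r) r (repIn-self r-rep) ⟩
              r                                                 ∎
          ; fixed       = λ r′≡r → ⊥-elim (¬r⇝r⁻¹ (double-sym (subst (Double (r ⁻¹)) r′≡r r⁻¹⇝r′))) }
          where
          open ≡-Reasoning
          spec = nth-satisfies ε (repIn (r ⁻¹)) (rank (repIn r) r)
                   (subst (rank (repIn r) r <_) (cosets-⁻¹ r) (rank<count (repIn r) r (repIn-self r-rep)))
          r′ = nth ε (repIn (r ⁻¹)) (rank (repIn r) r)
          r′∈ = proj₁ spec
          rank-r′ = proj₂ spec
          r⁻¹⇝r′ : Double (r ⁻¹) r′
          r⁻¹⇝r′ = repIn-double r′∈
          r⇝r′⁻¹ : Double r (r′ ⁻¹)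
          r⇝r′⁻¹ = double-⁻¹′ r⁻¹⇝r′
          ¬r′⇝r′⁻¹ : ¬ Double r′ (r′ ⁻¹)
          ¬r′⇝r′⁻¹ r′⇝r′⁻¹ = ¬r⇝r⁻¹ (double-trans r⇝r′⁻¹ (double-sym (double-trans r⁻¹⇝r′ r′⇝r′⁻¹)))

      partner-spec : ∀ r → rep r ≡ r → IsPartner r (partner r)
      partner-spec r r-rep with double? r (r ⁻¹) | cosets r ≟ 1
      ... | yes r⇝r⁻¹ | yes single = single-case r r-rep r⇝r⁻¹ single
      ... | yes r⇝r⁻¹ | no ¬single = swap-case r r-rep r⇝r⁻¹ ¬single
      ... | no ¬r⇝r⁻¹ | _          = transfer-case r r-rep ¬r⇝r⁻¹

      linked : Carrier → Carrier → Carrier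
      linked r₁ r₂ = first ε (λ u → inH (u ∙ r₁ ⁻¹) ∧ inH (u ⁻¹ ∙ r₂ ⁻¹))

      linked-spec : ∀ {r₁ r₂} → Double (r₁ ⁻¹) r₂ → linked r₁ r₂ ~ r₁ × linked r₁ r₂ ⁻¹ ~ r₂
      linked-spec {r₁} {r₂} (k , k∈H , r₂~r₁⁻¹k) =
        inH⇒H (T-∧-proj₁ found) , inH⇒H (T-∧-proj₂ {inH (linked r₁ r₂ ∙ r₁ ⁻¹)} found)
        where
        u⁻¹≡r₁⁻¹k : (k ⁻¹ ∙ r₁) ⁻¹ ≡ r₁ ⁻¹ ∙ k
        u⁻¹≡r₁⁻¹k = trans (⁻¹-anti-homo-∙ (k ⁻¹) r₁) (cong (r₁ ⁻¹ ∙_) (⁻¹-involutive k))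
        found = first-satisfies ε (λ u → inH (u ∙ r₁ ⁻¹) ∧ inH (u ⁻¹ ∙ r₂ ⁻¹)) (k ⁻¹ ∙ r₁)
          (T-∧-intro (H⇒inH (~-left (H-⁻¹ k∈H))) (H⇒inH (subst (_~ r₂) (sym u⁻¹≡r₁⁻¹k) (~-sym r₂~r₁⁻¹k))))

      involution : Carrier → Carrier
      involution r = first ε (λ u → inH (u ∙ r ⁻¹) ∧ (u ∙ u == ε))

      involution-spec : ∀ {r} → (Σ Carrier λ h → H h × (h ∙ r) ∙ (h ∙ r) ≡ ε) →
        involution r ~ r × involution r ∙ involution r ≡ ε
      involution-spec {r} (h , h∈H , hr²≡ε) = inH⇒H (T-∧-proj₁ found) , toWitness (T-∧-proj₂ {inH (involution r ∙ r ⁻¹)} found)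
        where found = first-satisfies ε (λ u → inH (u ∙ r ⁻¹) ∧ (u ∙ u == ε)) (h ∙ r)
                        (T-∧-intro (H⇒inH (~-left h∈H)) (fromWitness hr²≡ε))

      -- The element of the connection set in the coset H r; the comparison of indices
      -- decides which of two paired cosets gets the linked element and which its inverse.
      choice : Carrier → Carrier
      choice r with partner r ≟ᶠ r | toℕ r <? toℕ (partner r)
      ... | yes _ | _     = involution r
      ... | no _  | yes _ = linked r (partner r)
      ... | no _  | no _  = linked (partner r) r ⁻¹

      choice-fixed : ∀ {r} → partner r ≡ r → choice r ≡ involution r
      choice-fixed {r} fixed with partner r ≟ᶠ r
      ... | yes _     = refl
      ... | no ¬fixed = ⊥-elim (¬fixed fixed)

      choice-< : ∀ {r} → partner r ≢ r → toℕ r < toℕ (partner r) → choice r ≡ linked r (partner r)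
      choice-< {r} ¬fixed r< with partner r ≟ᶠ r | toℕ r <? toℕ (partner r)
      ... | yes fixed | _     = ⊥-elim (¬fixed fixed)
      ... | no _      | yes _ = refl
      ... | no _      | no ¬< = ⊥-elim (¬< r<)

      choice-≮ : ∀ {r} → partner r ≢ r → ¬ toℕ r < toℕ (partner r) → choice r ≡ linked (partner r) r ⁻¹
      choice-≮ {r} ¬fixed ¬< with partner r ≟ᶠ r | toℕ r <? toℕ (partner r)
      ... | yes fixed | _     = ⊥-elim (¬fixed fixed)
      ... | no _      | yes < = ⊥-elim (¬< <)
      ... | no _      | no _  = refl

      InvolutionCondition : Set
      InvolutionCondition = ∀ a → Normalizer H a → ¬ H a → H (pow a 2) → Σ Carrier λ h → H h × (h ∙ a) ∙ (h ∙ a) ≡ ε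

      module _ (involutions : InvolutionCondition) where

        fixed-involution : ∀ {r} → rep r ≡ r → ¬ H r → partner r ≡ r → Σ Carrier λ h → H h × (h ∙ r) ∙ (h ∙ r) ≡ ε
        fixed-involution {r} r-rep r∉H fixed with IsPartner.fixed (partner-spec r r-rep) fixed
        ... | single , r⇝r⁻¹ =
          involutions r (cosets≡1⇒normalizer single) r∉H (subst H r⁻²⁻¹≡r² (H-⁻¹ (cosets≡1⇒~ single r⇝r⁻¹)))
          where
          r⁻²⁻¹≡r² : (r ⁻¹ ∙ r ⁻¹) ⁻¹ ≡ pow r 2
          r⁻²⁻¹≡r² = trans (⁻¹-anti-homo-∙ (r ⁻¹) (r ⁻¹))
                       (trans (cong₂ _∙_ (⁻¹-involutive r) (⁻¹-involutive r)) (sym (pow-2 r)))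

        choice-~ : ∀ {r} → rep r ≡ r → ¬ H r → choice r ~ r
        choice-~ {r} r-rep r∉H = by-cases (partner r ≟ᶠ r) (toℕ r <? toℕ (partner r))
          where
          partner-in = IsPartner.partner-in (partner-spec r r-rep)
          by-cases : Dec (partner r ≡ r) → Dec (toℕ r < toℕ (partner r)) → choice r ~ r
          by-cases (yes fixed) _ =
            subst (_~ r) (sym (choice-fixed fixed)) (proj₁ (involution-spec (fixed-involution r-rep r∉H fixed)))
          by-cases (no ¬fixed) (yes <) =
            subst (_~ r) (sym (choice-< ¬fixed <)) (proj₁ (linked-spec partner-in))
          by-cases (no ¬fixed) (no ¬<) =
            subst (_~ r) (sym (choice-≮ ¬fixed ¬<)) (proj₂ (linked-spec (double-sym (double-⁻¹′ partner-in))))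

        choice-⁻¹ : ∀ {r} → rep r ≡ r → ¬ H r → rep (choice r ⁻¹) ≡ partner r × choice (partner r) ≡ choice r ⁻¹
        choice-⁻¹ {r} r-rep r∉H = by-cases (partner r ≟ᶠ r) (toℕ r <? toℕ (partner r))
          where
          open IsPartner (partner-spec r r-rep)
          open ≡-Reasoning
          p = partner r
          by-cases : Dec (p ≡ r) → Dec (toℕ r < toℕ p) → rep (choice r ⁻¹) ≡ p × choice p ≡ choice r ⁻¹
          by-cases (yes fixed) _ =
            trans (cong rep v⁻¹≡v) (trans (rep-cong (choice-~ r-rep r∉H)) (trans r-rep (sym fixed))) ,
            trans (cong choice fixed) (sym v⁻¹≡v)
            where
            v⁻¹≡v : choice r ⁻¹ ≡ choice r
            v⁻¹≡v = trans (cong _⁻¹ (choice-fixed fixed))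
              (trans (sym (inverseʳ-unique _ _ (proj₂ (involution-spec (fixed-involution r-rep r∉H fixed)))))
                     (sym (choice-fixed fixed)))
          by-cases (no ¬fixed) (yes r<p) =
            trans (cong (λ u → rep (u ⁻¹)) (choice-< ¬fixed r<p)) (trans (rep-cong (proj₂ (linked-spec partner-in))) rep-partner) ,
            (begin
              choice p              ≡⟨ choice-≮ p-not-fixed (λ p<r → <-asym r<p (subst (λ u → toℕ p < toℕ u) involutive p<r)) ⟩
              linked (partner p) p ⁻¹ ≡⟨ cong (λ u → linked u p ⁻¹) involutive ⟩
              linked r p ⁻¹         ≡⟨ cong _⁻¹ (sym (choice-< ¬fixed r<p)) ⟩
              choice r ⁻¹           ∎)
            where
            p-not-fixed : partner p ≢ p
            p-not-fixed e = ¬fixed (trans (sym e) involutive)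
          by-cases (no ¬fixed) (no r≮p) =
            trans (cong rep u⁻¹⁻¹≡u) (trans (rep-cong (proj₁ (linked-spec r⁻¹-in))) rep-partner) ,
            (begin
              choice p              ≡⟨ choice-< p-not-fixed (subst (λ u → toℕ p < toℕ u) (sym involutive) p<r) ⟩
              linked p (partner p)  ≡⟨ cong (linked p) involutive ⟩
              linked p r            ≡⟨ sym u⁻¹⁻¹≡u ⟩
              choice r ⁻¹           ∎)
            where
            r⁻¹-in = double-sym (double-⁻¹′ partner-in)
            u⁻¹⁻¹≡u : choice r ⁻¹ ≡ linked p r
            u⁻¹⁻¹≡u = trans (cong _⁻¹ (choice-≮ ¬fixed r≮p)) (⁻¹-involutive (linked p r))
            p-not-fixed : partner p ≢ p
            p-not-fixed e = ¬fixed (trans (sym e) involutive)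
            p<r : toℕ p < toℕ r
            p<r = ≤∧≢⇒< (≮⇒≥ r≮p) (λ e → ¬fixed (toℕ-injective e))

        inS : Carrier → Bool
        inS t = not (inH t) ∧ (t == choice (rep t))

        S : Subset order
        S = tabulate inS

        ∈S⇒ : ∀ {t} → t ∈ S → ¬ H t × t ≡ choice (rep t)
        ∈S⇒ {t} t∈S = toWitnessFalse (T-∧-proj₁ {not (inH t)} t∈) , toWitness (T-∧-proj₂ {not (inH t)} t∈)
          where
          t∈ : T (inS t)
          t∈ = subst T (sym (trans (sym (lookup∘tabulate inS t)) ([]=⇒lookup t∈S))) tt

        ⇒∈S : ∀ {t} → ¬ H t → t ≡ choice (rep t) → t ∈ S
        ⇒∈S {t} t∉H t≡ = lookup⇒[]= t S (trans (lookup∘tabulate inS t)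
          (T⇒≡true (T-∧-intro {not (inH t)} (fromWitnessFalse t∉H) (fromWitness t≡))))
          where
          T⇒≡true : ∀ {b} → T b → b ≡ true
          T⇒≡true {true} _ = refl

        S-connection : IsConnectionSet S
        S-connection = (λ ε∈S → proj₁ (∈S⇒ ε∈S) H-ε) , inverse-closed
          where
          inverse-closed : ∀ s → s ∈ S → s ⁻¹ ∈ S
          inverse-closed s s∈S with ∈S⇒ s∈S
          ... | s∉H , s≡ = ⇒∈S (λ s⁻¹∈H → s∉H (H-⁻¹⁻ s⁻¹∈H)) (begin
            s ⁻¹                        ≡⟨ cong _⁻¹ s≡ ⟩
            choice r ⁻¹                 ≡⟨ sym (proj₂ spec) ⟩
            choice (partner r)          ≡⟨ cong choice (sym (proj₁ spec)) ⟩
            choice (rep (choice r ⁻¹))  ≡⟨ cong (λ u → choice (rep (u ⁻¹))) (sym s≡) ⟩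
            choice (rep (s ⁻¹))         ∎)
            where
            open ≡-Reasoning
            r = rep s
            spec = choice-⁻¹ (rep-idem s) (rep-∉H s∉H)

        H-perfect-in-S : IsPerfectCodeIn S H
        H-perfect-in-S = independent , covering
          where
          independent : ∀ c c′ → H c → H c′ → ¬ Adj S c c′
          independent c c′ c∈H c′∈H (s , s∈S , c′≡sc) =
            proj₁ (∈S⇒ s∈S) (subst H (sym (x≈z//y s c c′ (sym c′≡sc))) (H-∙ c′∈H (H-⁻¹ c∈H)))
          covering : ∀ v → ¬ H v → Σ Carrier λ c → H c × Adj S v c × (∀ c′ → H c′ → Adj S v c′ → c′ ≡ c)
          covering v v∉H = s ∙ v , sv∈H , (s , s∈S , refl) , unique
            where
            r = rep (v ⁻¹)
            r∉H : ¬ H r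
            r∉H = rep-∉H (λ v⁻¹∈H → v∉H (H-⁻¹⁻ v⁻¹∈H))
            s = choice r
            s~r : s ~ r
            s~r = choice-~ (rep-idem (v ⁻¹)) r∉H
            sv∈H : H (s ∙ v)
            sv∈H = subst H (cong (s ∙_) (⁻¹-involutive v)) (~-trans s~r (~-sym (rep-~ (v ⁻¹))))
            s∈S : s ∈ S
            s∈S = ⇒∈S (λ s∈H → r∉H (~-H (~-sym s~r) s∈H)) (cong choice (sym (trans (rep-cong s~r) (rep-idem (v ⁻¹)))))
            unique : ∀ c′ → H c′ → Adj S v c′ → c′ ≡ s ∙ v
            unique c′ c′∈H (s′ , s′∈S , c′≡s′v) =
              trans c′≡s′v (cong (_∙ v) (trans (proj₂ (∈S⇒ s′∈S)) (cong choice (rep-cong s′~v⁻¹))))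
              where
              s′~v⁻¹ : s′ ~ v ⁻¹
              s′~v⁻¹ = subst H (trans c′≡s′v (cong (s′ ∙_) (sym (⁻¹-involutive v)))) c′∈H

        perfect-code : IsPerfectCodeOf H
        perfect-code = S , S-connection , H-perfect-in-S

  module Semidihedral (m : ℕ) (x y : Carrier)
    (x^N≡ε : pow x (2 ^ (3 + m)) ≡ ε) (x^N/2≢ε : pow x (2 ^ (2 + m)) ≢ ε)
    (y²≡ε : pow y 2 ≡ ε) (y∉⟨x⟩ : ¬ ⟨ x ⟩₁ y) (x^y≡ : x ˆ y ≡ x ⁻¹ ∙ pow x (2 ^ (2 + m))) where

    open import Data.Nat using (zero; suc; _*_; _<_; NonZero)
    open import Relation.Binary.PropositionalEquality
    open NatFacts
    open Counting
    open import Data.Nat.Properties using (m^n≢0; m^n>0; +-identityʳ; *-comm; *-assoc; *-distribʳ-+; *-distribˡ-+; +-suc)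
    open import Data.Nat.DivMod using (_%_; m%n<n)
    open import Data.Nat.Divisibility using (_∣_; divides; *-cancelˡ-∣)
    open import Data.Nat.Coprimality using (coprime-divisor)
    import Data.Nat.Coprimality as Coprimality
    open import Data.Nat.Tactic.RingSolver using (solve-∀)
    open import Data.Bool using (Bool; true; T)
    open import Data.Unit using (tt)
    open import Data.Fin using (Fin; toℕ; fromℕ<)
    open import Data.Fin.Properties using (any?; toℕ<n; toℕ-fromℕ<; toℕ-injective) renaming (_≟_ to _≟ᶠ_)
    open import Relation.Unary using (Decidable)
    open import Relation.Nullary using (map′)
    open import Relation.Nullary.Decidable using (⌊_⌋; toWitness; fromWitness; _⊎-dec_)
    open import Function using (_∘_)
    open import Data.Product using (Σ; _×_; _,_; proj₁; proj₂; map₂)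
    open import Data.Sum using (_⊎_; inj₁; inj₂)
    open import Data.Empty using (⊥-elim)
    open ≡-Reasoning

    N half quarter : ℕ
    N       = 2 ^ (3 + m)
    half    = 2 ^ (2 + m)
    quarter = 2 ^ (1 + m)

    instance
      N≢0 : NonZero N
      N≢0 = m^n≢0 2 (3 + m)

    A H : Carrier → Set
    A = ⟨ x ⟩₁
    H = ⟨ x , y ⟩₂

    c d : Carrier
    c = pow x half
    d = pow x quarter

    x∈A : A x
    x∈A = gen refl

    y∈H : H y
    y∈H = gen (inj₂ refl)

    A⊆H : ∀ {z} → A z → H z
    A⊆H (gen refl)    = gen (inj₁ refl)
    A⊆H one           = one
    A⊆H (mul z∈ w∈)   = mul (A⊆H z∈) (A⊆H w∈)
    A⊆H (inv z∈)      = inv (A⊆H z∈)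

    pow-x∈A : ∀ i → A (pow x i)
    pow-x∈A = ⟨⟩-pow x∈A

    A-pow : ∀ {z} → A z → Σ ℕ λ i → z ≡ pow x i
    A-pow = cyclic-pow N x^N≡ε

    A-comm : ∀ {z w} → A z → A w → z ∙ w ≡ w ∙ z
    A-comm = cyclic-comm

    y∙y≡ε : y ∙ y ≡ ε
    y∙y≡ε = trans (sym (pow-2 y)) y²≡ε

    y⁻¹≡y : y ⁻¹ ≡ y
    y⁻¹≡y = sym (inverseʳ-unique y y y∙y≡ε)

    N≡half+half : N ≡ half + half
    N≡half+half = cong (half +_) (+-identityʳ half)

    half≡quarter+quarter : half ≡ quarter + quarter
    half≡quarter+quarter = cong (quarter +_) (+-identityʳ quarter)

    c∙c≡ε : c ∙ c ≡ ε
    c∙c≡ε = trans (sym (pow-+ x half half)) (trans (cong (pow x) (sym N≡half+half)) x^N≡ε)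

    d∙d≡c : d ∙ d ≡ c
    d∙d≡c = trans (sym (pow-+ x quarter quarter)) (cong (pow x) (sym half≡quarter+quarter))

    σ : Carrier → Carrier
    σ z = z ˆ y

    σ-A : ∀ {z} → A z → A (σ z)
    σ-A (gen refl)  = subst A (sym x^y≡) (mul (inv x∈A) (pow-x∈A half))
    σ-A one         = subst A (sym (ˆ-ε y)) one
    σ-A (mul z∈ w∈) = subst A (sym (ˆ-∙ _ _ y)) (mul (σ-A z∈) (σ-A w∈))
    σ-A (inv z∈)    = subst A (sym (ˆ-⁻¹ _ y)) (inv (σ-A z∈))

    σ≡yzy : ∀ z → σ z ≡ y ∙ z ∙ y
    σ≡yzy z = cong (λ u → u ∙ z ∙ y) y⁻¹≡y

    σ-σ : ∀ z → σ (σ z) ≡ z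
    σ-σ z = trans (cong (λ u → (z ˆ u) ˆ y) (sym y⁻¹≡y)) (ˆ-⁻¹-ˆ z y)

    y∙≡σ∙y : ∀ z → y ∙ z ≡ σ z ∙ y
    y∙≡σ∙y z = trans (cong (y ∙_) (sym (σ-σ z))) (∙-ˆ (σ z) y)

    -- On ⟨x⟩, τ is the homomorphism x^i ↦ c^i, whose kernel is the subgroup of squares.
    τ : Carrier → Carrier
    τ z = z ∙ σ z

    τ-x : τ x ≡ c
    τ-x = trans (cong (x ∙_) x^y≡) (\\-leftDividesˡ x c)

    τ-∙ : ∀ {z w} → A z → A w → τ (z ∙ w) ≡ τ z ∙ τ w
    τ-∙ {z} {w} z∈ w∈ = trans (cong (z ∙ w ∙_) (ˆ-∙ z w y)) (interchange z w (σ z) (σ w) (A-comm w∈ (σ-A z∈)))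

    τ-pow : ∀ i → τ (pow x i) ≡ pow c i
    τ-pow zero    = trans (cong (ε ∙_) (ˆ-ε y)) (identityˡ ε)
    τ-pow (suc i) = trans (τ-∙ x∈A (pow-x∈A i)) (cong₂ _∙_ τ-x (τ-pow i))

    σ≡⁻¹∙τ : ∀ z → σ z ≡ z ⁻¹ ∙ τ z
    σ≡⁻¹∙τ z = y≈x\\z z (σ z) (τ z) refl

    ∙y-square : ∀ w → w ∙ y ∙ (w ∙ y) ≡ τ w
    ∙y-square w = begin
      w ∙ y ∙ (w ∙ y)  ≡⟨ assoc w y (w ∙ y) ⟩
      w ∙ (y ∙ (w ∙ y)) ≡⟨ cong (w ∙_) (sym (assoc y w y)) ⟩
      w ∙ (y ∙ w ∙ y)   ≡⟨ cong (w ∙_) (sym (σ≡yzy w)) ⟩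
      w ∙ σ w          ∎

    Sign : Carrier → Set
    Sign e = e ≡ ε ⊎ e ≡ c

    sign-square : ∀ {e} → Sign e → e ∙ e ≡ ε
    sign-square (inj₁ refl) = identityˡ ε
    sign-square (inj₂ refl) = c∙c≡ε

    pow-c-sign : ∀ i → Sign (pow c i)
    pow-c-sign zero    = inj₁ refl
    pow-c-sign (suc i) with pow-c-sign i
    ... | inj₁ e = inj₂ (trans (cong (c ∙_) e) (identityʳ c))
    ... | inj₂ e = inj₁ (trans (cong (c ∙_) e) c∙c≡ε)

    pow-c-even : ∀ s → pow c (s + s) ≡ ε
    pow-c-even s = trans (pow-+ c s s) (sign-square (pow-c-sign s))

    pow-c-odd : ∀ s → pow c (suc (s + s)) ≡ c
    pow-c-odd s = trans (cong (c ∙_) (pow-c-even s)) (identityʳ c)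

    data Parity (w : Carrier) : Set where
      square    : ∀ {v} → A v → w ≡ v ∙ v → τ w ≡ ε → Parity w
      nonsquare : ∀ {v} → A v → w ≡ x ∙ (v ∙ v) → τ w ≡ c → Parity w

    parity-A : ∀ {w} → A w → Parity w
    parity-A w∈ with A-pow w∈
    ... | i , refl with parity i
    ...   | s , inj₁ refl = square (pow-x∈A s) (pow-+ x s s) (trans (τ-pow (s + s)) (pow-c-even s))
    ...   | s , inj₂ refl = nonsquare (pow-x∈A s) (cong (x ∙_) (pow-+ x s s)) (trans (τ-pow (suc (s + s))) (pow-c-odd s))

    τ-preimage : ∀ {e} → Sign e → Σ Carrier λ h → A h × τ h ≡ e
    τ-preimage (inj₁ refl) = ε , one , τ-pow 0
    τ-preimage (inj₂ refl) = x , x∈A , τ-x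

    τ-sign : ∀ {w} → A w → Sign (τ w)
    τ-sign w∈ with parity-A w∈
    ... | square    _ _ τw≡ε = inj₁ τw≡ε
    ... | nonsquare _ _ τw≡c = inj₂ τw≡c

    ∙y∙y : ∀ g → g ∙ y ∙ y ≡ g
    ∙y∙y g = trans (assoc g y y) (trans (cong (g ∙_) y∙y≡ε) (identityʳ g))

    ∙y∙σ : ∀ p q → p ∙ y ∙ σ q ≡ p ∙ (q ∙ y)
    ∙y∙σ p q = trans (cong (p ∙ y ∙_) (assoc (y ⁻¹) q y)) (cancel-middle⁻¹ p y (q ∙ y))

    ∙y∙[∙y] : ∀ p q → p ∙ y ∙ (q ∙ y) ≡ p ∙ σ q
    ∙y∙[∙y] p q = begin
      p ∙ y ∙ (q ∙ y)   ≡⟨ assoc p y (q ∙ y) ⟩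
      p ∙ (y ∙ (q ∙ y)) ≡⟨ cong (p ∙_) (sym (assoc y q y)) ⟩
      p ∙ (y ∙ q ∙ y)   ≡⟨ cong (p ∙_) (sym (σ≡yzy q)) ⟩
      p ∙ σ q           ∎

    NormalForm : Carrier → Set
    NormalForm g = A g ⊎ A (g ∙ y)

    normal-form-∙ : ∀ {g h} → NormalForm g → NormalForm h → NormalForm (g ∙ h)
    normal-form-∙ (inj₁ g∈) (inj₁ h∈) = inj₁ (mul g∈ h∈)
    normal-form-∙ (inj₁ g∈) (inj₂ h∈) = inj₂ (subst A (sym (assoc _ _ y)) (mul g∈ h∈))
    normal-form-∙ {g} {h} (inj₂ g∈) (inj₁ h∈) =
      inj₂ (subst A (trans (∙y∙σ g h) (sym (assoc g h y))) (mul g∈ (σ-A h∈)))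
    normal-form-∙ {g} {h} (inj₂ g∈) (inj₂ h∈) =
      inj₁ (subst A (trans (∙y∙σ g (h ∙ y)) (cong (g ∙_) (∙y∙y h))) (mul g∈ (σ-A h∈)))

    normal-form-⁻¹ : ∀ {g} → NormalForm g → NormalForm (g ⁻¹)
    normal-form-⁻¹ (inj₁ g∈) = inj₁ (inv g∈)
    normal-form-⁻¹ {g} (inj₂ g∈) = inj₂ (subst A σ[gy⁻¹]≡g⁻¹y (σ-A (inv g∈)))
      where
      σ[gy⁻¹]≡g⁻¹y : σ ((g ∙ y) ⁻¹) ≡ g ⁻¹ ∙ y
      σ[gy⁻¹]≡g⁻¹y = begin
        σ ((g ∙ y) ⁻¹)        ≡⟨ σ≡yzy _ ⟩
        y ∙ (g ∙ y) ⁻¹ ∙ y    ≡⟨ cong (λ u → y ∙ u ∙ y) (trans (⁻¹-anti-homo-∙ g y) (cong (_∙ g ⁻¹) y⁻¹≡y)) ⟩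
        y ∙ (y ∙ g ⁻¹) ∙ y    ≡⟨ cong (_∙ y) (sym (assoc y y (g ⁻¹))) ⟩
        y ∙ y ∙ g ⁻¹ ∙ y      ≡⟨ cong (λ u → u ∙ g ⁻¹ ∙ y) y∙y≡ε ⟩
        ε ∙ g ⁻¹ ∙ y          ≡⟨ cong (_∙ y) (identityˡ (g ⁻¹)) ⟩
        g ⁻¹ ∙ y              ∎

    H⇒normal-form : ∀ {g} → H g → NormalForm g
    H⇒normal-form (gen (inj₁ refl)) = inj₁ x∈A
    H⇒normal-form (gen (inj₂ refl)) = inj₂ (subst A (sym y∙y≡ε) one)
    H⇒normal-form one               = inj₁ one
    H⇒normal-form (mul g∈ h∈)       = normal-form-∙ (H⇒normal-form g∈) (H⇒normal-form h∈)
    H⇒normal-form (inv g∈)          = normal-form-⁻¹ (H⇒normal-form g∈)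

    normal-form⇒H : ∀ {g} → NormalForm g → H g
    normal-form⇒H (inj₁ g∈) = A⊆H g∈
    normal-form⇒H (inj₂ g∈) = ⟨⟩-cancelʳ (A⊆H g∈) y∈H

    Normalizes : Carrier → Set
    Normalizes b = ∀ {g} → H g → H (g ˆ b)

    τ-square : ∀ {w} → A w → τ w ∙ τ w ≡ ε
    τ-square w∈ = sign-square (τ-sign w∈)

    ∉A⇒pow4≡ε : ∀ {g} → A (g ∙ y) → pow g 4 ≡ ε
    ∉A⇒pow4≡ε {g} gy∈ = begin
      pow g 4                  ≡⟨ cong (λ u → g ∙ (g ∙ (g ∙ u))) (identityʳ g) ⟩
      g ∙ (g ∙ (g ∙ g))        ≡⟨ sym (assoc g g (g ∙ g)) ⟩
      g ∙ g ∙ (g ∙ g)          ≡⟨ cong (λ u → u ∙ u) g∙g≡τ ⟩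
      τ (g ∙ y) ∙ τ (g ∙ y)    ≡⟨ τ-square gy∈ ⟩
      ε                        ∎
      where
      g∙g≡τ : g ∙ g ≡ τ (g ∙ y)
      g∙g≡τ = trans (cong₂ _∙_ (sym (∙y∙y g)) (sym (∙y∙y g))) (∙y-square (g ∙ y))

    x^4≢ε : pow x 4 ≢ ε
    x^4≢ε x^4≡ε = x^N/2≢ε (begin
      pow x half               ≡⟨ cong (pow x) (sym (*-assoc 2 2 (2 ^ m))) ⟩
      pow x (4 * 2 ^ m)        ≡⟨ pow-*ˡ x 4 (2 ^ m) ⟩
      pow (pow x 4) (2 ^ m)    ≡⟨ cong (λ u → pow u (2 ^ m)) x^4≡ε ⟩
      pow ε (2 ^ m)            ≡⟨ pow-ε (2 ^ m) ⟩
      ε                        ∎)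

    -- Elements of H outside ⟨x⟩ have order dividing 4, while x has order 2^(3+m) ≥ 8.
    A-characteristic : ∀ {b} → Normalizes b → ∀ {z} → A z → A (z ˆ b)
    A-characteristic {b} conj-H (gen refl) with H⇒normal-form (conj-H (A⊆H x∈A))
    ... | inj₁ xᵇ∈A = xᵇ∈A
    ... | inj₂ xᵇy∈A = ⊥-elim (x^4≢ε (ˆ-injective (pow x 4) ε b
                          (trans (ˆ-pow x 4 b) (trans (∉A⇒pow4≡ε xᵇy∈A) (sym (ˆ-ε b))))))
    A-characteristic conj-H one         = subst A (sym (ˆ-ε _)) one
    A-characteristic conj-H (mul z∈ w∈) = subst A (sym (ˆ-∙ _ _ _)) (mul (A-characteristic conj-H z∈) (A-characteristic conj-H w∈))
    A-characteristic conj-H (inv z∈)    = subst A (sym (ˆ-⁻¹ _ _)) (inv (A-characteristic conj-H z∈))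

    order-x : ∀ a → pow x a ≡ ε → N ∣ a
    order-x = pow≡ε⇒2^[1+k]∣ x (2 + m) x^N≡ε x^N/2≢ε

    A-pow< : ∀ {z} → A z → Σ ℕ λ i → i < N × z ≡ pow x i
    A-pow< z∈ with A-pow z∈
    ... | i , z≡x^i = i % N , m%n<n i N , trans z≡x^i (pow-% x N x^N≡ε i)

    A? : Decidable A
    A? z = map′ (λ { (i , z≡x^i) → subst A (sym z≡x^i) (pow-x∈A (toℕ i)) })
                (λ z∈ → let (i , i<N , z≡x^i) = A-pow< z∈ in fromℕ< i<N , trans z≡x^i (cong (pow x) (sym (toℕ-fromℕ< i<N))))
                (any? λ i → z ≟ᶠ pow x (toℕ i))

    H? : Decidable H
    H? g = map′ normal-form⇒H H⇒normal-form (A? g ⊎-dec A? (g ∙ y))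

    inA inH : Carrier → Bool
    inA z = ⌊ A? z ⌋
    inH g = ⌊ H? g ⌋

    ∣A∣≡N : count inA ≡ N
    ∣A∣≡N = trans (sym (count-bijection (λ (_ : Fin N) → true) inA exp log
                         (λ i _ → fromWitness (pow-x∈A (toℕ i))) (λ _ _ → tt) log∘exp exp∘log))
                  (count-all {N} (λ _ → true) (λ _ → tt))
      where
      exp : Fin N → Carrier
      exp i = pow x (toℕ i)
      log : Carrier → Fin N
      log z = first (fromℕ< (m^n>0 2 (3 + m))) (λ i → exp i == z)
      log-spec : ∀ z i → exp i ≡ z → exp (log z) ≡ z
      log-spec z i e = toWitness (first-satisfies (fromℕ< (m^n>0 2 (3 + m))) (λ i → exp i == z) i (fromWitness e))
      log∘exp : ∀ i → T true → log (exp i) ≡ i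
      log∘exp i _ = toℕ-injective (pow-injective x N order-x _ _ (toℕ<n _) (toℕ<n i) (log-spec (exp i) i refl))
      exp∘log : ∀ z → T (inA z) → exp (log z) ≡ z
      exp∘log z z∈ with A-pow< (toWitness z∈)
      ... | i , i<N , z≡x^i = log-spec z (fromℕ< i<N) (trans (cong (pow x) (toℕ-fromℕ< i<N)) (sym z≡x^i))

    ∣H∣≡2^[4+m] : count inH ≡ 2 ^ (4 + m)
    ∣H∣≡2^[4+m] = begin
      count inH                        ≡⟨ count-disjoint-∪ inA (λ g → inA (g ∙ y)) inH split (λ g t → fromWitness (normal-form⇒H (inj₁ (toWitness t))))
                                            (λ g t → fromWitness (normal-form⇒H (inj₂ (toWitness t)))) disjoint ⟩
      count inA + count (λ g → inA (g ∙ y)) ≡⟨ cong (count inA +_) ∣Ay∣≡∣A∣ ⟩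
      count inA + count inA            ≡⟨ cong₂ _+_ ∣A∣≡N ∣A∣≡N ⟩
      N + N                            ≡⟨ cong (N +_) (sym (+-identityʳ N)) ⟩
      2 ^ (4 + m)                      ∎
      where
      split : ∀ g → T (inH g) → T (inA g) ⊎ T (inA (g ∙ y))
      split g g∈ with H⇒normal-form (toWitness g∈)
      ... | inj₁ g∈A  = inj₁ (fromWitness g∈A)
      ... | inj₂ gy∈A = inj₂ (fromWitness gy∈A)
      disjoint : ∀ g → T (inA g) → ¬ T (inA (g ∙ y))
      disjoint g g∈ gy∈ = y∉⟨x⟩ (⟨⟩-cancelˡ (toWitness gy∈) (toWitness g∈))
      ∣Ay∣≡∣A∣ : count (λ g → inA (g ∙ y)) ≡ count inA
      ∣Ay∣≡∣A∣ = count-bijection _ inA (_∙ y) (_∙ y) (λ _ t → t) (λ g t → subst (T ∘ inA) (sym (∙y∙y g)) t)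
                   (λ g _ → ∙y∙y g) (λ g _ → ∙y∙y g)

    A-pow-N : ∀ {t} → A t → pow t N ≡ ε
    A-pow-N t∈ with A-pow t∈
    ... | i , refl = trans (sym (pow-* x N i)) (trans (cong (pow x) (*-comm N i)) (pow-vanish x i N x^N≡ε))

    pow-half≡τ : ∀ {g} → A g → pow g half ≡ τ g
    pow-half≡τ g∈ with A-pow g∈
    ... | k , refl = begin
      pow (pow x k) half   ≡⟨ sym (pow-* x half k) ⟩
      pow x (half * k)     ≡⟨ cong (pow x) (*-comm half k) ⟩
      pow x (k * half)     ≡⟨ pow-* x k half ⟩
      pow c k              ≡⟨ sym (τ-pow k) ⟩
      τ (pow x k)          ∎

    involution-A : ∀ {g} → A g → g ∙ g ≡ ε → Sign g
    involution-A g∈ g∙g≡ε with A-pow g∈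
    ... | i , refl with *-cancelˡ-∣ {half} {i} 2
                          (subst (N ∣_) (cong (i +_) (sym (+-identityʳ i))) (order-x (i + i) (trans (pow-+ x i i) g∙g≡ε)))
    ... | divides q refl = subst Sign (sym (pow-* x q half)) (pow-c-sign q)

    double-quarter : ∀ q → q * quarter + q * quarter ≡ q * half
    double-quarter q = trans (sym (*-distribˡ-+ q quarter quarter)) (cong (q *_) (sym half≡quarter+quarter))

    quarter∣s*[1+s] : ∀ s → pow x (suc (s + s) * suc (s + s)) ≡ x → quarter ∣ s * suc s
    quarter∣s*[1+s] s x^r²≡x = *-cancelˡ-∣ {quarter} {s * suc s} 4
      (subst (_∣ 4 * (s * suc s)) (sym (*-assoc 2 2 quarter)) (order-x (4 * (s * suc s)) x^4T≡ε))
      where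
      r²≡1+4T : ∀ s → suc (s + s) * suc (s + s) ≡ suc (4 * (s * suc s))
      r²≡1+4T = solve-∀
      x^4T≡ε : pow x (4 * (s * suc s)) ≡ ε
      x^4T≡ε = sym (∙-cancelˡ x ε _ (trans (identityʳ x) (sym (trans (cong (pow x) (sym (r²≡1+4T s))) x^r²≡x))))

    image-when-quarter∣s : ∀ s → quarter ∣ s → Σ Carrier λ e → Sign e × pow x (suc (s + s)) ≡ x ∙ e
    image-when-quarter∣s s (divides q s≡q*quarter) = pow c q , pow-c-sign q ,
      cong (x ∙_) (trans (cong (pow x) (trans (cong₂ _+_ s≡q*quarter s≡q*quarter) (double-quarter q))) (pow-* x q half))

    image-when-quarter∣1+s : ∀ s → quarter ∣ suc s → Σ Carrier λ e → Sign e × pow x (suc (s + s)) ≡ x ⁻¹ ∙ e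
    image-when-quarter∣1+s s (divides q 1+s≡q*quarter) = pow c q , pow-c-sign q ,
      trans (x≈z//y _ x (pow c q) x^r∙x≡c^q) (A-comm (⟨⟩-pow (pow-x∈A half) q) (inv x∈A))
      where
      x^r∙x≡c^q : pow x (suc (s + s)) ∙ x ≡ pow c q
      x^r∙x≡c^q = begin
        pow x (suc (s + s)) ∙ x      ≡⟨ sym (pow-sucʳ x (suc (s + s))) ⟩
        pow x (suc (suc (s + s)))    ≡⟨ cong (pow x ∘ suc) (sym (+-suc s s)) ⟩
        pow x (suc s + suc s)        ≡⟨ cong (pow x) (trans (cong₂ _+_ 1+s≡q*quarter 1+s≡q*quarter) (double-quarter q)) ⟩
        pow x (q * half)             ≡⟨ pow-* x q half ⟩
        pow c q                      ∎

    -- x^r with r² ≡ 1 (mod 2^(3+m)) is the image of x under an involutive automorphism of ⟨x⟩.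
    involutive-image : ∀ r → pow x (r * r) ≡ x → Σ Carrier λ e → Sign e × (pow x r ≡ x ∙ e ⊎ pow x r ≡ x ⁻¹ ∙ e)
    involutive-image r x^r²≡x with parity r
    ... | s , inj₁ refl = ⊥-elim (x^N/2≢ε (begin
      c                  ≡⟨ sym τ-x ⟩
      τ x                ≡⟨ cong τ (sym x^r²≡x) ⟩
      τ (pow x ((s + s) * (s + s)))  ≡⟨ cong (τ ∘ pow x) (*-distribʳ-+ (s + s) s s) ⟩
      τ (pow x (t + t))  ≡⟨ τ-pow (t + t) ⟩
      pow c (t + t)      ≡⟨ pow-c-even t ⟩
      ε                  ∎))
      where t = s * (s + s)
    ... | s , inj₂ refl with parity s
    ...   | t , inj₁ s≡t+t = map₂ (map₂ inj₁) (image-when-quarter∣s s (coprime-divisor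
              (Coprimality.sym (odd⇒coprime-2^ (suc s) (1 + m) (subst (¬_ ∘ (2 ∣_) ∘ suc) (sym s≡t+t) (odd-¬2∣ t))))
              (subst (quarter ∣_) (*-comm s (suc s)) (quarter∣s*[1+s] s x^r²≡x))))
    ...   | t , inj₂ s≡1+t+t = map₂ (map₂ inj₂) (image-when-quarter∣1+s s (coprime-divisor
              (Coprimality.sym (odd⇒coprime-2^ s (1 + m) (subst (¬_ ∘ (2 ∣_)) (sym s≡1+t+t) (odd-¬2∣ t))))
              (quarter∣s*[1+s] s x^r²≡x)))

    τ-⁻¹ : ∀ {z} → A z → τ (z ⁻¹) ≡ τ z
    τ-⁻¹ {z} z∈ = trans (inverseʳ-unique (τ z) (τ (z ⁻¹)) (trans (sym (τ-∙ z∈ (inv z∈))) (trans (cong τ (inverseʳ z)) τ-ε)))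
                        (sign-⁻¹ (τ-sign z∈))
      where
      τ-ε : τ ε ≡ ε
      τ-ε = τ-pow 0
      sign-⁻¹ : ∀ {e} → Sign e → e ⁻¹ ≡ e
      sign-⁻¹ s = sym (inverseʳ-unique _ _ (sign-square s))

    c^quarter≡ε : pow c quarter ≡ ε
    c^quarter≡ε = trans (cong (pow c) (cong (2 ^ m +_) (+-identityʳ (2 ^ m)))) (pow-c-even (2 ^ m))

    -- Raising to the power 2^(1+m) kills fourth powers but sends g² c to τ g = c.
    pow4≢pow2∙c : ∀ {t g} → A t → A g → τ g ≡ c → pow t 4 ≢ pow g 2 ∙ c
    pow4≢pow2∙c {t} {g} t∈ g∈ τg≡c t⁴≡g²c = x^N/2≢ε (begin
      c                                      ≡⟨ sym τg≡c ⟩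
      τ g                                    ≡⟨ sym (pow-half≡τ g∈) ⟩
      pow g half                             ≡⟨ sym (identityʳ _) ⟩
      pow g half ∙ ε                         ≡⟨ cong₂ _∙_ (pow-*ˡ g 2 quarter) (sym c^quarter≡ε) ⟩
      pow (pow g 2) quarter ∙ pow c quarter  ≡⟨ sym (pow-∙-comm _ c (A-comm (⟨⟩-pow g∈ 2) (pow-x∈A half)) quarter) ⟩
      pow (pow g 2 ∙ c) quarter              ≡⟨ cong (λ u → pow u quarter) (sym t⁴≡g²c) ⟩
      pow (pow t 4) quarter                  ≡⟨ sym (pow-*ˡ t 4 quarter) ⟩
      pow t (4 * quarter)                    ≡⟨ cong (pow t) (*-assoc 2 2 quarter) ⟩
      pow t N                                ≡⟨ A-pow-N t∈ ⟩
      ε                                      ∎)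

    sqτ : Carrier → Carrier
    sqτ z = z ∙ z ∙ τ z

    sqτ-∙ : ∀ {p q} → A p → A q → sqτ (p ∙ q) ≡ sqτ p ∙ sqτ q
    sqτ-∙ {p} {q} p∈ q∈ = begin
      p ∙ q ∙ (p ∙ q) ∙ τ (p ∙ q)          ≡⟨ cong₂ _∙_ (interchange p q p q (A-comm q∈ p∈)) (τ-∙ p∈ q∈) ⟩
      p ∙ p ∙ (q ∙ q) ∙ (τ p ∙ τ q)        ≡⟨ interchange (p ∙ p) (q ∙ q) (τ p) (τ q) (A-comm (mul q∈ q∈) (τ-A p∈)) ⟩
      p ∙ p ∙ τ p ∙ (q ∙ q ∙ τ q)          ∎
      where
      τ-A : ∀ {z} → A z → A (τ z)
      τ-A z∈ = mul z∈ (σ-A z∈)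

    sqτ-ε : sqτ ε ≡ ε
    sqτ-ε = trans (cong₂ _∙_ (identityʳ ε) (τ-pow 0)) (identityʳ ε)

    sqτ-d : sqτ d ≡ c
    sqτ-d = trans (cong₂ _∙_ d∙d≡c (trans (τ-pow quarter) c^quarter≡ε)) (identityʳ c)

    sqτ-∙-adjust : ∀ {v b e} → A v → A b → τ v ∙ sqτ b ≡ e → sqτ (v ∙ b) ≡ v ∙ v ∙ e
    sqτ-∙-adjust {v} {b} {e} v∈ b∈ τv∙sq≡e = begin
      sqτ (v ∙ b)            ≡⟨ sqτ-∙ v∈ b∈ ⟩
      v ∙ v ∙ τ v ∙ sqτ b    ≡⟨ assoc (v ∙ v) (τ v) (sqτ b) ⟩
      v ∙ v ∙ (τ v ∙ sqτ b)  ≡⟨ cong (v ∙ v ∙_) τv∙sq≡e ⟩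
      v ∙ v ∙ e              ∎

    -- Multiplying v by d = x^(2^(1+m)) multiplies sqτ v by c.
    sqτ-solve : ∀ {v e} → A v → Sign e → Σ Carrier λ b → A b × sqτ (v ∙ b) ≡ v ∙ v ∙ e
    sqτ-solve v∈ e-sign with τ-sign v∈ | e-sign
    ... | inj₁ τv≡ε | inj₁ refl = ε , one , sqτ-∙-adjust v∈ one (trans (cong₂ _∙_ τv≡ε sqτ-ε) (identityˡ ε))
    ... | inj₁ τv≡ε | inj₂ refl = d , pow-x∈A quarter , sqτ-∙-adjust v∈ (pow-x∈A quarter) (trans (cong₂ _∙_ τv≡ε sqτ-d) (identityˡ c))
    ... | inj₂ τv≡c | inj₁ refl = d , pow-x∈A quarter , sqτ-∙-adjust v∈ (pow-x∈A quarter) (trans (cong₂ _∙_ τv≡c sqτ-d) c∙c≡ε)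
    ... | inj₂ τv≡c | inj₂ refl = ε , one , sqτ-∙-adjust v∈ one (trans (cong₂ _∙_ τv≡c sqτ-ε) (identityʳ c))

    normalizer⇒normalizes : ∀ {a} → Normalizer H a → Normalizes a × Normalizes (a ⁻¹)
    normalizer⇒normalizes {a} a-norm =
      (λ {g} g∈ → proj₁ (a-norm g) g∈) ,
      (λ {g} g∈ → proj₂ (a-norm (g ˆ (a ⁻¹))) (subst H (sym (ˆ-⁻¹-ˆ g a)) g∈))

    yᵇ∙y∈A : ∀ {b} → Normalizes b → Normalizes (b ⁻¹) → A (y ˆ b ∙ y)
    yᵇ∙y∈A {b} b-norm b⁻¹-norm with H⇒normal-form (b-norm y∈H)
    ... | inj₁ yᵇ∈A = ⊥-elim (y∉⟨x⟩ (subst A (ˆ-ˆ-⁻¹ y b) (A-characteristic b⁻¹-norm yᵇ∈A)))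
    ... | inj₂ yᵇy∈A = yᵇy∈A

    involution-square∈A : ∀ {s c₀} → s ⁻¹ ≡ s → Normalizes s → H c₀ → A (c₀ ˆ s ∙ c₀)
    involution-square∈A {s} {c₀} s⁻¹≡s s-norm c₀∈H with H⇒normal-form c₀∈H
    ... | inj₁ c₀∈A = mul (A-characteristic s-norm c₀∈A) c₀∈A
    ... | inj₂ c₀y∈A = subst A (sym split) (mul (A-characteristic s-norm c₀y∈A) (mul (yᵇ∙y∈A s-norm s⁻¹-norm) (σ-A c₀y∈A)))
      where
      s⁻¹-norm : Normalizes (s ⁻¹)
      s⁻¹-norm = subst Normalizes (sym s⁻¹≡s) s-norm
      w = c₀ ∙ y
      split : c₀ ˆ s ∙ c₀ ≡ w ˆ s ∙ (y ˆ s ∙ y ∙ σ w)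
      split = begin
        c₀ ˆ s ∙ c₀                      ≡⟨ cong (λ u → u ˆ s ∙ u) (sym (∙y∙y c₀)) ⟩
        (w ∙ y) ˆ s ∙ (w ∙ y)            ≡⟨ cong (_∙ (w ∙ y)) (ˆ-∙ w y s) ⟩
        w ˆ s ∙ y ˆ s ∙ (w ∙ y)          ≡⟨ assoc (w ˆ s) (y ˆ s) (w ∙ y) ⟩
        w ˆ s ∙ (y ˆ s ∙ (w ∙ y))        ≡⟨ cong (w ˆ s ∙_) (sym (∙y∙σ (y ˆ s) w)) ⟩
        w ˆ s ∙ (y ˆ s ∙ y ∙ σ w)        ∎

    perfect-code⇒squares∈A : IsPerfectCodeOf H → ∀ a → Normalizer H a → ¬ H a → H (pow a 2) → A (pow a 2)
    perfect-code⇒squares∈A (S , (_ , S-inverse) , (_ , cover)) a a-norm a∉H a²∈H with cover a a∉H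
    ... | c₀ , c₀∈H , (s , s∈S , c₀≡sa) , unique = subst A (sym a²≡c₀ˢc₀) (involution-square∈A s⁻¹≡s s-norm c₀∈H)
      where
      a⁻¹-norm : Normalizes (a ⁻¹)
      a⁻¹-norm = proj₂ (normalizer⇒normalizes a-norm)
      s≡c₀a⁻¹ : s ≡ c₀ ∙ a ⁻¹
      s≡c₀a⁻¹ = x≈z//y s a c₀ (sym c₀≡sa)
      s⁻¹a∈H : H (s ⁻¹ ∙ a)
      s⁻¹a∈H = subst H s⁻¹a≡ (mul (a⁻¹-norm (inv c₀∈H)) a²∈H)
        where
        s⁻¹a≡ : (c₀ ⁻¹) ˆ (a ⁻¹) ∙ pow a 2 ≡ s ⁻¹ ∙ a
        s⁻¹a≡ = begin
          a ⁻¹ ⁻¹ ∙ c₀ ⁻¹ ∙ a ⁻¹ ∙ pow a 2    ≡⟨ cong (a ⁻¹ ⁻¹ ∙ c₀ ⁻¹ ∙ a ⁻¹ ∙_) (pow-2 a) ⟩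
          a ⁻¹ ⁻¹ ∙ c₀ ⁻¹ ∙ a ⁻¹ ∙ (a ∙ a)    ≡⟨ cancel-middle (a ⁻¹ ⁻¹ ∙ c₀ ⁻¹) a a ⟩
          a ⁻¹ ⁻¹ ∙ c₀ ⁻¹ ∙ a                 ≡⟨ cong (_∙ a) (sym (⁻¹-anti-homo-∙ c₀ (a ⁻¹))) ⟩
          (c₀ ∙ a ⁻¹) ⁻¹ ∙ a                  ≡⟨ cong (λ u → u ⁻¹ ∙ a) (sym s≡c₀a⁻¹) ⟩
          s ⁻¹ ∙ a                            ∎
      -- a is also adjacent to s⁻¹ a ∈ H, so s⁻¹ a = c₀ = s a.
      s⁻¹≡s : s ⁻¹ ≡ s
      s⁻¹≡s = ∙-cancelʳ a (s ⁻¹) s (trans (unique (s ⁻¹ ∙ a) s⁻¹a∈H (s ⁻¹ , S-inverse s s∈S , refl)) c₀≡sa)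
      s-norm : Normalizes s
      s-norm {g} g∈ = subst H (trans (ˆ-ˆ g c₀ (a ⁻¹)) (cong (g ˆ_) (sym s≡c₀a⁻¹)))
        (a⁻¹-norm (mul (mul (inv c₀∈H) g∈) c₀∈H))
      a≡sc₀ : a ≡ s ∙ c₀
      a≡sc₀ = trans (y≈x\\z s a c₀ (sym c₀≡sa)) (cong (_∙ c₀) s⁻¹≡s)
      a²≡c₀ˢc₀ : pow a 2 ≡ c₀ ˆ s ∙ c₀
      a²≡c₀ˢc₀ = begin
        pow a 2              ≡⟨ pow-2 a ⟩
        a ∙ a                ≡⟨ cong (λ u → u ∙ u) a≡sc₀ ⟩
        s ∙ c₀ ∙ (s ∙ c₀)    ≡⟨ sym (assoc (s ∙ c₀) s c₀) ⟩
        s ∙ c₀ ∙ s ∙ c₀      ≡⟨ cong (λ u → u ∙ c₀ ∙ s ∙ c₀) (sym s⁻¹≡s) ⟩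
        c₀ ˆ s ∙ c₀          ∎

    module _ {a : Carrier} (a-norm : Normalizer H a) (a²∈A : A (pow a 2)) where

      private
        g : Carrier
        g = pow a 2

        -- conjugation by a⁻¹, so that (h a)² = h φ(h) g
        φ : Carrier → Carrier
        φ z = z ˆ (a ⁻¹)

        φ-H : Normalizes (a ⁻¹)
        φ-H = proj₂ (normalizer⇒normalizes a-norm)

        φ⁻¹-H : Normalizes (a ⁻¹ ⁻¹)
        φ⁻¹-H = subst Normalizes (sym (⁻¹-involutive a)) (proj₁ (normalizer⇒normalizes a-norm))

        φ-A : ∀ {z} → A z → A (φ z)
        φ-A = A-characteristic φ-H

        square≡ : ∀ h → (h ∙ a) ∙ (h ∙ a) ≡ h ∙ φ h ∙ g
        square≡ h = sym (begin
          h ∙ (a ⁻¹ ⁻¹ ∙ h ∙ a ⁻¹) ∙ pow a 2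
            ≡⟨ cong₂ (λ u v → h ∙ (u ∙ h ∙ a ⁻¹) ∙ v) (⁻¹-involutive a) (pow-2 a) ⟩
          h ∙ (a ∙ h ∙ a ⁻¹) ∙ (a ∙ a)         ≡⟨ cong (_∙ (a ∙ a)) (sym (assoc h (a ∙ h) (a ⁻¹))) ⟩
          h ∙ (a ∙ h) ∙ a ⁻¹ ∙ (a ∙ a)         ≡⟨ cancel-middle (h ∙ (a ∙ h)) a a ⟩
          h ∙ (a ∙ h) ∙ a                      ≡⟨ cong (_∙ a) (sym (assoc h a h)) ⟩
          h ∙ a ∙ h ∙ a                        ≡⟨ assoc (h ∙ a) h a ⟩
          h ∙ a ∙ (h ∙ a)                      ∎)

        φ-g : φ g ≡ g
        φ-g = trans (ˆ-pow a 2 (a ⁻¹)) (cong (λ u → pow u 2) (ˆ-comm a (a ⁻¹) (trans (inverseʳ a) (sym (inverseˡ a)))))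

        φ-φ : ∀ z → φ (φ z) ≡ z ˆ (g ⁻¹)
        φ-φ z = trans (ˆ-ˆ z (a ⁻¹) (a ⁻¹)) (cong (z ˆ_) (trans (sym (⁻¹-anti-homo-∙ a a)) (cong _⁻¹ (sym (pow-2 a)))))

        φ-φ-A : ∀ {z} → A z → φ (φ z) ≡ z
        φ-φ-A {z} z∈ = trans (φ-φ z) (ˆ-comm z (g ⁻¹) (A-comm z∈ (inv a²∈A)))

        u : Carrier
        u = φ y ∙ y

        u∈A : A u
        u∈A = yᵇ∙y∈A φ-H φ⁻¹-H

        φy≡u∙y : φ y ≡ u ∙ y
        φy≡u∙y = sym (∙y∙y (φ y))

        τu≡ε : τ u ≡ ε
        τu≡ε = begin
          τ u                ≡⟨ sym (∙y-square u) ⟩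
          u ∙ y ∙ (u ∙ y)    ≡⟨ cong (λ v → v ∙ v) (sym φy≡u∙y) ⟩
          φ y ∙ φ y          ≡⟨ sym (ˆ-∙ y y (a ⁻¹)) ⟩
          φ (y ∙ y)          ≡⟨ cong φ y∙y≡ε ⟩
          φ ε                ≡⟨ ˆ-ε (a ⁻¹) ⟩
          ε                  ∎

        u-square : Σ Carrier λ t → A t × u ≡ t ∙ t
        u-square with parity-A u∈A
        ... | square    t∈ u≡tt _    = _ , t∈ , u≡tt
        ... | nonsquare _  _    τu≡c = ⊥-elim (x^N/2≢ε (trans (sym τu≡c) τu≡ε))

        φ-on-A : ∀ (F : Carrier → Carrier) → (∀ i → pow (φ x) i ≡ F (pow x i)) → ∀ {z} → A z → φ z ≡ F z
        φ-on-A F pow-φx {z} z∈ with A-pow z∈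
        ... | i , refl = trans (ˆ-pow x i (a ⁻¹)) (pow-φx i)

        InvolutionInCoset : Set
        InvolutionInCoset = Σ Carrier λ h → H h × (h ∙ a) ∙ (h ∙ a) ≡ ε

        inverse-square : ∀ v → v ⁻¹ ∙ v ⁻¹ ∙ (v ∙ v) ≡ ε
        inverse-square v = trans (cancel-middle (v ⁻¹) v v) (inverseˡ v)

        φ-identity-case : (∀ {z} → A z → φ z ≡ z) → InvolutionInCoset
        φ-identity-case φ≡id with parity-A a²∈A
        ... | square {v} v∈ g≡vv _ = v ⁻¹ , A⊆H (inv v∈) , (begin
          (v ⁻¹ ∙ a) ∙ (v ⁻¹ ∙ a)       ≡⟨ square≡ (v ⁻¹) ⟩
          v ⁻¹ ∙ φ (v ⁻¹) ∙ g           ≡⟨ cong₂ (λ p q → v ⁻¹ ∙ p ∙ q) (φ≡id (inv v∈)) g≡vv ⟩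
          v ⁻¹ ∙ v ⁻¹ ∙ (v ∙ v)         ≡⟨ inverse-square v ⟩
          ε                             ∎)
        ... | nonsquare _ _ τg≡c with u-square
        ...   | t , t∈ , u≡tt = ⊥-elim (pow4≢pow2∙c t∈ a²∈A τg≡c (begin
          pow t 4                 ≡⟨ cong (λ v → t ∙ (t ∙ (t ∙ v))) (identityʳ t) ⟩
          t ∙ (t ∙ (t ∙ t))       ≡⟨ sym (assoc t t (t ∙ t)) ⟩
          t ∙ t ∙ (t ∙ t)         ≡⟨ cong (λ v → v ∙ v) (sym u≡tt) ⟩
          u ∙ u                   ≡⟨ ∙-cancelʳ y (u ∙ u) (g ∙ σ (g ⁻¹)) u∙u∙y≡ ⟩
          g ∙ σ (g ⁻¹)
            ≡⟨ cong (g ∙_) (trans (σ≡⁻¹∙τ (g ⁻¹)) (cong₂ _∙_ (⁻¹-involutive g) (trans (τ-⁻¹ a²∈A) τg≡c))) ⟩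
          g ∙ (g ∙ c)             ≡⟨ sym (assoc g g c) ⟩
          g ∙ g ∙ c               ≡⟨ cong (_∙ c) (sym (pow-2 g)) ⟩
          pow g 2 ∙ c             ∎))
          where
          u∙u∙y≡ : u ∙ u ∙ y ≡ g ∙ σ (g ⁻¹) ∙ y
          u∙u∙y≡ = begin
            u ∙ u ∙ y             ≡⟨ assoc u u y ⟩
            u ∙ (u ∙ y)           ≡⟨ cong₂ _∙_ (sym (φ≡id u∈A)) (sym φy≡u∙y) ⟩
            φ u ∙ φ y             ≡⟨ sym (ˆ-∙ u y (a ⁻¹)) ⟩
            φ (u ∙ y)             ≡⟨ cong φ (sym φy≡u∙y) ⟩
            φ (φ y)               ≡⟨ φ-φ y ⟩
            g ⁻¹ ⁻¹ ∙ y ∙ g ⁻¹    ≡⟨ cong (λ v → v ∙ y ∙ g ⁻¹) (⁻¹-involutive g) ⟩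
            g ∙ y ∙ g ⁻¹          ≡⟨ assoc g y (g ⁻¹) ⟩
            g ∙ (y ∙ g ⁻¹)        ≡⟨ cong (g ∙_) (y∙≡σ∙y (g ⁻¹)) ⟩
            g ∙ (σ (g ⁻¹) ∙ y)    ≡⟨ sym (assoc g (σ (g ⁻¹)) y) ⟩
            g ∙ σ (g ⁻¹) ∙ y      ∎

        φ-twist-case : (∀ {z} → A z → φ z ≡ z ∙ τ z) → InvolutionInCoset
        φ-twist-case φ≡twist with parity-A a²∈A
        ... | nonsquare _ _ τg≡c = ⊥-elim (x^N/2≢ε (trans (sym τg≡c) τg≡ε))
          where
          τg≡ε : τ g ≡ ε
          τg≡ε = ∙-cancelˡ g (τ g) ε (trans (sym (φ≡twist a²∈A)) (trans φ-g (sym (identityʳ g))))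
        ... | square {v} v∈ g≡vv _ with sqτ-solve (inv v∈) (inj₁ refl)
        ...   | b , b∈ , sq≡ = h , A⊆H h∈ , (begin
          (h ∙ a) ∙ (h ∙ a)             ≡⟨ square≡ h ⟩
          h ∙ φ h ∙ g                   ≡⟨ cong (λ p → h ∙ p ∙ g) (φ≡twist h∈) ⟩
          h ∙ (h ∙ τ h) ∙ g             ≡⟨ cong (_∙ g) (sym (assoc h h (τ h))) ⟩
          sqτ h ∙ g                     ≡⟨ cong₂ _∙_ (trans sq≡ (identityʳ _)) g≡vv ⟩
          v ⁻¹ ∙ v ⁻¹ ∙ (v ∙ v)         ≡⟨ inverse-square v ⟩
          ε                             ∎)
          where
          h = v ⁻¹ ∙ b
          h∈ : A h
          h∈ = mul (inv v∈) b∈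

        φ-inverse⇒g∙g≡ε : (∀ {z} → A z → φ z ≡ z ⁻¹) → g ∙ g ≡ ε
        φ-inverse⇒g∙g≡ε φ≡⁻¹ = trans (cong (g ∙_) (trans (sym φ-g) (φ≡⁻¹ a²∈A))) (inverseʳ g)

        φ-inverse-case : (∀ {z} → A z → φ z ≡ z ⁻¹) → InvolutionInCoset
        φ-inverse-case φ≡⁻¹ with u-square
        ... | t , t∈ , u≡tt with sqτ-solve t∈ (involution-A a²∈A (φ-inverse⇒g∙g≡ε φ≡⁻¹))
        ...   | b , b∈ , sq≡ = z ∙ y , mul (A⊆H z∈) y∈H , (begin
          (z ∙ y ∙ a) ∙ (z ∙ y ∙ a)         ≡⟨ square≡ (z ∙ y) ⟩
          z ∙ y ∙ φ (z ∙ y) ∙ g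
            ≡⟨ cong (λ p → z ∙ y ∙ p ∙ g) (trans (ˆ-∙ z y (a ⁻¹)) (cong₂ _∙_ (φ≡⁻¹ z∈) φy≡u∙y)) ⟩
          z ∙ y ∙ (z ⁻¹ ∙ (u ∙ y)) ∙ g      ≡⟨ cong (λ p → z ∙ y ∙ p ∙ g) (sym (assoc (z ⁻¹) u y)) ⟩
          z ∙ y ∙ (z ⁻¹ ∙ u ∙ y) ∙ g        ≡⟨ cong (_∙ g) (∙y∙[∙y] z (z ⁻¹ ∙ u)) ⟩
          z ∙ σ (z ⁻¹ ∙ u) ∙ g              ≡⟨ cong (λ p → z ∙ p ∙ g) (ˆ-∙ (z ⁻¹) u y) ⟩
          z ∙ (σ (z ⁻¹) ∙ σ u) ∙ g          ≡⟨ cong (λ p → z ∙ (p ∙ σ u) ∙ g) σz⁻¹≡zτz ⟩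
          z ∙ (z ∙ τ z ∙ σ u) ∙ g
            ≡⟨ cong (_∙ g) (trans (sym (assoc z (z ∙ τ z) (σ u))) (cong (_∙ σ u) (sym (assoc z z (τ z))))) ⟩
          sqτ z ∙ σ u ∙ g                   ≡⟨ cong₂ (λ p q → p ∙ q ∙ g) sq≡ σu≡u⁻¹ ⟩
          t ∙ t ∙ g ∙ u ⁻¹ ∙ g              ≡⟨ cong (λ p → p ∙ g ∙ u ⁻¹ ∙ g) (sym u≡tt) ⟩
          u ∙ g ∙ u ⁻¹ ∙ g                  ≡⟨ cong (λ p → p ∙ u ⁻¹ ∙ g) (A-comm u∈A a²∈A) ⟩
          g ∙ u ∙ u ⁻¹ ∙ g                  ≡⟨ cong (_∙ g) (//-rightDividesʳ u g) ⟩
          g ∙ g                             ≡⟨ g∙g≡ε ⟩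
          ε                                 ∎)
          where
          z = t ∙ b
          z∈ : A z
          z∈ = mul t∈ b∈
          σz⁻¹≡zτz : σ (z ⁻¹) ≡ z ∙ τ z
          σz⁻¹≡zτz = trans (σ≡⁻¹∙τ (z ⁻¹)) (cong₂ _∙_ (⁻¹-involutive z) (τ-⁻¹ z∈))
          σu≡u⁻¹ : σ u ≡ u ⁻¹
          σu≡u⁻¹ = trans (σ≡⁻¹∙τ u) (trans (cong (u ⁻¹ ∙_) τu≡ε) (identityʳ (u ⁻¹)))
          g∙g≡ε : g ∙ g ≡ ε
          g∙g≡ε = φ-inverse⇒g∙g≡ε φ≡⁻¹

        φ-σ⇒τg≡g∙g : (∀ {z} → A z → φ z ≡ σ z) → τ g ≡ g ∙ g
        φ-σ⇒τg≡g∙g φ≡σ = cong (g ∙_) (trans (sym (φ≡σ a²∈A)) φ-g)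

        φ-σ-case : (∀ {z} → A z → φ z ≡ σ z) → InvolutionInCoset
        φ-σ-case φ≡σ with τ-sign a²∈A
        ... | inj₂ τg≡c = ⊥-elim (pow4≢pow2∙c one a²∈A τg≡c (sym (begin
          pow g 2 ∙ c     ≡⟨ cong (_∙ c) (trans (pow-2 g) (sym (φ-σ⇒τg≡g∙g φ≡σ))) ⟩
          τ g ∙ c         ≡⟨ cong (_∙ c) τg≡c ⟩
          c ∙ c           ≡⟨ c∙c≡ε ⟩
          ε               ≡⟨ sym (pow-ε 4) ⟩
          pow ε 4         ∎)))
        ... | inj₁ τg≡ε with τ-preimage (involution-A a²∈A (trans (sym (φ-σ⇒τg≡g∙g φ≡σ)) τg≡ε))
        ...   | h , h∈ , τh≡g = h , A⊆H h∈ , (begin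
          (h ∙ a) ∙ (h ∙ a)   ≡⟨ square≡ h ⟩
          h ∙ φ h ∙ g         ≡⟨ cong (λ p → h ∙ p ∙ g) (φ≡σ h∈) ⟩
          τ h ∙ g             ≡⟨ cong (_∙ g) τh≡g ⟩
          g ∙ g               ≡⟨ trans (sym (φ-σ⇒τg≡g∙g φ≡σ)) τg≡ε ⟩
          ε                   ∎)

      coset-involution : Σ Carrier λ h → H h × (h ∙ a) ∙ (h ∙ a) ≡ ε
      coset-involution with A-pow (φ-A x∈A)
      ... | r , φx≡x^r with involutive-image r x^r²≡x
        where
        x^r²≡x : pow x (r * r) ≡ x
        x^r²≡x = begin
          pow x (r * r)      ≡⟨ pow-*ˡ x r r ⟩
          pow (pow x r) r    ≡⟨ cong (λ w → pow w r) (sym φx≡x^r) ⟩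
          pow (φ x) r        ≡⟨ sym (ˆ-pow x r (a ⁻¹)) ⟩
          φ (pow x r)        ≡⟨ cong φ (sym φx≡x^r) ⟩
          φ (φ x)            ≡⟨ φ-φ-A x∈A ⟩
          x                  ∎
      ...   | _ , inj₁ refl , inj₁ x^r≡x∙ε = φ-identity-case (φ-on-A (λ z → z) λ i →
        cong (λ w → pow w i) (trans φx≡x^r (trans x^r≡x∙ε (identityʳ x))))
      ...   | _ , inj₂ refl , inj₁ x^r≡x∙c = φ-twist-case (φ-on-A (λ z → z ∙ τ z) λ i → begin
        pow (φ x) i                ≡⟨ cong (λ w → pow w i) (trans φx≡x^r x^r≡x∙c) ⟩
        pow (x ∙ c) i              ≡⟨ pow-∙-comm x c (A-comm x∈A (pow-x∈A half)) i ⟩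
        pow x i ∙ pow c i          ≡⟨ cong (pow x i ∙_) (sym (τ-pow i)) ⟩
        pow x i ∙ τ (pow x i)      ∎)
      ...   | _ , inj₁ refl , inj₂ x^r≡x⁻¹∙ε = φ-inverse-case (φ-on-A _⁻¹ λ i → begin
        pow (φ x) i                ≡⟨ cong (λ w → pow w i) (trans φx≡x^r (trans x^r≡x⁻¹∙ε (identityʳ (x ⁻¹)))) ⟩
        pow (x ⁻¹) i               ≡⟨ sym (pow-⁻¹ x i) ⟩
        pow x i ⁻¹                 ∎)
      ...   | _ , inj₂ refl , inj₂ x^r≡x⁻¹∙c = φ-σ-case (φ-on-A σ λ i → begin
        pow (φ x) i                ≡⟨ cong (λ w → pow w i) (trans φx≡x^r (trans x^r≡x⁻¹∙c (sym x^y≡))) ⟩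
        pow (σ x) i                ≡⟨ sym (ˆ-pow x i y) ⟩
        σ (pow x i)                ∎)

corollary3p6 : (n : ℕ) → 3 ≤ n → (G : FiniteGroup) → let open FiniteGroup G in
    (x y : Carrier) →
    pow x (2 ^ n) ≡ ε → pow x (2 ^ (n ∸ 1)) ≢ ε →
    pow y 2 ≡ ε → ¬ ⟨ x ⟩₁ y →
    x ˆ y ≡ x ⁻¹ ∙ pow x (2 ^ (n ∸ 1)) →
    IsPerfectCodeOf ⟨ x , y ⟩₂
      ⇔ (∀ a → Normalizer ⟨ x , y ⟩₂ a → ¬ ⟨ x , y ⟩₂ a → ⟨ x , y ⟩₂ (pow a 2) → ⟨ x ⟩₁ (pow a 2))
corollary3p6 (suc (suc (suc m))) (s≤s (s≤s (s≤s _))) G x y x^N≡ε x^N/2≢ε y²≡ε y∉⟨x⟩ x^y≡ =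
  mk⇔ SD.perfect-code⇒squares∈A
      (λ squares∈A → PC.TwoPowerOrder.perfect-code (4 + m) SD.∣H∣≡2^[4+m]
        λ a a-norm a∉H a²∈H → SD.coset-involution a-norm (squares∈A a a-norm a∉H a²∈H))
  where
  open FiniteGroup G
  module SD = Semidihedral G m x y x^N≡ε x^N/2≢ε y²≡ε y∉⟨x⟩ x^y≡
  module PC = PerfectCodeCriterion G SD.H SD.H? one mul inv
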